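{- Let $G$ be a connected simple graph of order $n$ with chromatic number $\chi(G)=2$. (1) If $n$ is even, then $ABC(G)\leq \frac{n}{2}\sqrt{n-2}$, with equality if and only if $G\cong T_{n,2}$. (2) If $n$ is odd, then $ABC(G)\leq \frac{1}{2}\sqrt{(n-2)(n^2-1)}$, with equality if and only if $G\cong T_{n,2}$.
   Context: For a simple graph $G$, $d(u)$ denotes the degree of vertex $u$, and the atom-bond connectivity index is $ABC(G)=\sum_{uv\in E(G)}\sqrt{\frac{d(u)+d(v)-2}{d(u)d(v)}}$. The chromatic number $\chi(G)$ is the least number of colors in a proper vertex coloring of $G$. $T_{n,t}$ denotes the complete $t$-partite graph on $n$ vertices whose part sizes $n_1,\dots,n_t$ satisfy $|n_i-n_j|\le 1$ for all $i,j$; in particular $T_{n,2}$ is the complete bipartite graph $K_{\lfloor n/2\rfloor,\lceil n/2\rceil}$. -}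

module Defs where

open import Data.Nat as ℕ using (ℕ; zero; suc; _∸_; _<ᵇ_)
open import Data.Nat.DivMod using (_/_)
open import Data.Fin using (Fin; toℕ)
import Data.Fin as F
open import Data.Fin.Properties using (_<?_)
open import Data.Bool using (Bool; true; false; _∧_; _xor_; if_then_else_)
open import Data.Integer using (+_)
open import Data.Rational as ℚ using (ℚ; 0ℚ)
open import Data.Product using (Σ; _×_; _,_)
open import Function.Bundles using (_⤖_; Bijection)
open import Relation.Nullary using (¬_; ⌊_⌋)
open import Relation.Binary.PropositionalEquality using (_≡_; refl)

record Graph (n : ℕ) : Set where
  field
    adj    : Fin n → Fin n → Bool
    sym    : ∀ u v → adj u v ≡ adj v u
    irrefl : ∀ u → adj u u ≡ false
open Graph public

Adj : ∀ {n} → Graph n → Fin n → Fin n → Set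
Adj G u v = adj G u v ≡ true

sumℕ : ∀ {n} → (Fin n → ℕ) → ℕ
sumℕ {zero}  f = 0
sumℕ {suc n} f = f F.zero ℕ.+ sumℕ (λ i → f (F.suc i))

sumℚ : ∀ {n} → (Fin n → ℚ) → ℚ
sumℚ {zero}  f = 0ℚ
sumℚ {suc n} f = f F.zero ℚ.+ sumℚ (λ i → f (F.suc i))

deg : ∀ {n} → Graph n → Fin n → ℕ
deg G u = sumℕ (λ v → if adj G u v then 1 else 0)

data Reachable {n} (G : Graph n) : Fin n → Fin n → Set where
  here : ∀ {u} → Reachable G u u
  step : ∀ {u v w} → Adj G u v → Reachable G v w → Reachable G u w

Connected : ∀ {n} → Graph n → Set
Connected {n} G = ∀ (u v : Fin n) → Reachable G u v

Colorable : ∀ {n} → Graph n → ℕ → Set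
Colorable {n} G k =
  Σ (Fin n → Fin k) λ c → ∀ u v → Adj G u v → ¬ (c u ≡ c v)

ChromaticNumberIs : ∀ {n} → Graph n → ℕ → Set
ChromaticNumberIs G k = Colorable G k × (∀ m → m ℕ.< k → ¬ Colorable G m)

_≅_ : ∀ {n} → Graph n → Graph n → Set
_≅_ {n} G H = Σ (Fin n ⤖ Fin n) λ f →
  ∀ u v → adj G u v ≡ adj H (Bijection.to f u) (Bijection.to f v)

-- T_{n,2} = K_{⌊n/2⌋,⌈n/2⌉}: part of i is "toℕ i < ⌊n/2⌋"
private
  xor-comm' : ∀ x y → x xor y ≡ y xor x
  xor-comm' false false = refl
  xor-comm' false true  = refl
  xor-comm' true  false = refl
  xor-comm' true  true  = refl
  xor-self : ∀ x → x xor x ≡ false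
  xor-self false = refl
  xor-self true  = refl

T₂ : (n : ℕ) → Graph n
T₂ n = record
  { adj    = λ u v → part u xor part v
  ; sym    = λ u v → xor-comm' (part u) (part v)
  ; irrefl = λ u → xor-self (part u)
  }
  where
  part : Fin n → Bool
  part i = toℕ i <ᵇ (n / 2)

-- ABC index, compared with √b (b a nonnegative rational) exactly, via
-- rational approximations (no reals in the library).
-- The edge uv contributes √(num/den) with num = d(u)+d(v)-2, den = d(u)d(v).

ℕ→ℚ : ℕ → ℚ
ℕ→ℚ k = + k ℚ./ 1

edgeNum edgeDen : ∀ {n} → Graph n → Fin n → Fin n → ℚ
edgeNum G u v = ℕ→ℚ (deg G u ℕ.+ deg G v ∸ 2)
edgeDen G u v = ℕ→ℚ (deg G u ℕ.* deg G v)

-- q is a nonnegative rational with q ≤ √(num/den)   (den > 0 on edges)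
LowerApprox : ℚ → ℚ → ℚ → Set
LowerApprox q num den = (0ℚ ℚ.≤ q) × ((q ℚ.* q) ℚ.* den ℚ.≤ num)

-- p is a nonnegative rational with p ≥ √(num/den)
UpperApprox : ℚ → ℚ → ℚ → Set
UpperApprox p num den = (0ℚ ℚ.≤ p) × (num ℚ.≤ (p ℚ.* p) ℚ.* den)

edgeSum : ∀ {n} → Graph n → (Fin n → Fin n → ℚ) → ℚ
edgeSum G q = sumℚ (λ u → sumℚ (λ v →
  if adj G u v ∧ ⌊ u <? v ⌋ then q u v else 0ℚ))

-- ABC(G) ≤ √b : every sum of lower approximants of the edge terms is ≤ √b
ABC≤√ : ∀ {n} → Graph n → ℚ → Set
ABC≤√ {n} G b = ∀ (q : Fin n → Fin n → ℚ) →
  (∀ u v → Adj G u v → LowerApprox (q u v) (edgeNum G u v) (edgeDen G u v)) →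
  edgeSum G q ℚ.* edgeSum G q ℚ.≤ b

-- ABC(G) ≥ √b : every sum of upper approximants of the edge terms is ≥ √b
ABC≥√ : ∀ {n} → Graph n → ℚ → Set
ABC≥√ {n} G b = ∀ (p : Fin n → Fin n → ℚ) →
  (∀ u v → Adj G u v → UpperApprox (p u v) (edgeNum G u v) (edgeDen G u v)) →
  b ℚ.≤ edgeSum G p ℚ.* edgeSum G p

ABC≡√ : ∀ {n} → Graph n → ℚ → Set
ABC≡√ G b = ABC≤√ G b × ABC≥√ G b

-- squares of the two bounds:
-- ((n/2)√(n-2))² = n²(n-2)/4 ,  ((1/2)√((n-2)(n²-1)))² = (n-2)(n²-1)/4
boundEven² boundOdd² : ℕ → ℚ
boundEven² n = + (n ℕ.* n ℕ.* (n ∸ 2)) ℚ./ 4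
boundOdd² n = + ((n ∸ 2) ℕ.* (n ℕ.* n ∸ 1)) ℚ./ 4

module Submission where

-- Let β be a proper 2-colouring with classes of sizes n₁ + n₂ = n, P = n₁ n₂, and m edges.  A vertex
-- has at most as many neighbours as the opposite class has vertices, so m ≤ P and d(u) d(v) ≤ P on
-- every edge.  The squared ABC term of an edge is 1/d(u) + 1/d(v) − 2/(d(u) d(v)); summing over the
-- edges gives Σ abc² ≤ n − 2m/P, and by Cauchy–Schwarz ABC² ≤ m Σ abc² ≤ m (n − 2m/P) ≤ P (n − 2).
-- Finally P (n − 2) ≤ ⌊n/2⌋ ⌈n/2⌉ (n − 2), which is n²(n − 2)/4 or (n − 2)(n² − 1)/4.  Equality forces
-- m = P (so G is complete bipartite) and a balanced bipartition, i.e. G ≅ T_{n,2}; conversely every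
-- edge of T_{n,2} contributes exactly √((n − 2)/P).
--
-- Since ABC(G) ≤ √b and ABC(G) ≥ √b are stated through rational approximants of the edge terms, the
-- lower bound on m Σ abc² in the equality case uses the approximants (abc² + t²)/2t with t² close to
-- Σ abc²/m, which Newton's iteration provides.

open import Defs
open import Data.Nat using (ℕ)
open import Data.Nat.Divisibility using (_∣_)
open import Data.Product using (_×_)
open import Function.Bundles using (_⇔_)
open import Relation.Nullary using (¬_)

open import Data.Nat.Base as ℕ using (zero; suc; z≤n; s≤s; _∸_; ∣_-_∣; _<ᵇ_)
import Data.Nat.Properties as ℕ
import Data.Nat.DivMod as ℕ
import Data.Nat.Solver as ℕ-Solver
open import Data.Nat.Coprimality using (1-coprimeTo) renaming (sym to coprime-sym)
open import Data.Nat.Divisibility using (divides)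
open import Data.Integer.Base as ℤ using (+_)
import Data.Integer.Properties as ℤ
open import Data.Rational.Base
  using (ℚ; mkℚ; 0ℚ; 1ℚ; _/_; _+_; _*_; _-_; -_; _≤_; _<_; 1/_; toℚᵘ; nonNegative; positive; >-nonZero; *≤*; *<*)
import Data.Rational.Properties as ℚ
import Data.Rational.Unnormalised.Base as ℚᵘ
import Data.Rational.Unnormalised.Properties as ℚᵘ
import Data.Rational.Solver as ℚ-Solver
open import Data.Fin.Base using (Fin; zero; suc; toℕ; punchIn; punchOut)
open import Data.Fin.Properties
  using (_<?_; _≟_; <-asym; <-cmp; punchInᵢ≢i; punchIn-injective; punchIn-punchOut)
open import Data.Bool.Base using (Bool; true; false; if_then_else_; not; _∧_; _xor_)
open import Data.Bool.Properties using (not-involutive; not-distribˡ-xor; not-distribʳ-xor)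
open import Data.Product.Base using (Σ; _,_; proj₁; proj₂)
open import Data.Sum.Base using (_⊎_; inj₁; inj₂)
open import Data.Empty using (⊥-elim)
open import Relation.Nullary using (yes; no; ⌊_⌋)
open import Relation.Binary.Definitions using (tri<; tri≈; tri>)
open import Relation.Binary.PropositionalEquality as ≡
  using (_≡_; _≢_; refl; trans; cong; cong₂; subst; subst₂; module ≡-Reasoning)
open import Function.Bundles using (_⤖_; Bijection; mk⤖; mk⇔)
open import Function.Consequences.Propositional using (strictlySurjective⇒surjective)
open import Function.Properties.Bijection using (⤖⇒↔)
open import Algebra.Bundles using (Ring)
import Algebra.Properties.CommutativeMonoid.Sum as CommutativeMonoidSum
import Algebra.Properties.Semiring.Sum as SemiringSum

-- Arithmetic of bipartitions

module _ where

  open ℕ-Solver.+-*-Solver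

  square-of-sum-≤ : ∀ {a b} → a ℕ.≤ b → (a ℕ.+ b) ℕ.* (a ℕ.+ b) ≡ 4 ℕ.* (a ℕ.* b) ℕ.+ (b ∸ a) ℕ.* (b ∸ a)
  square-of-sum-≤ {a} {b} a≤b with b ∸ a | ℕ.m+[n∸m]≡n a≤b
  ... | k | refl = solve 2 (λ a k → (a :+ (a :+ k)) :* (a :+ (a :+ k)) := con 4 :* (a :* (a :+ k)) :+ k :* k) refl a k

  square-of-sum : ∀ a b → (a ℕ.+ b) ℕ.* (a ℕ.+ b) ≡ 4 ℕ.* (a ℕ.* b) ℕ.+ ∣ a - b ∣ ℕ.* ∣ a - b ∣
  square-of-sum a b with ℕ.≤-total a b
  ... | inj₁ a≤b rewrite ℕ.m≤n⇒∣m-n∣≡n∸m a≤b = square-of-sum-≤ a≤b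
  ... | inj₂ b≤a rewrite ℕ.m≤n⇒∣n-m∣≡n∸m b≤a | ℕ.+-comm a b | ℕ.*-comm a b = square-of-sum-≤ b≤a

  4*ab≤[a+b]² : ∀ a b → 4 ℕ.* (a ℕ.* b) ℕ.≤ (a ℕ.+ b) ℕ.* (a ℕ.+ b)
  4*ab≤[a+b]² a b = subst (4 ℕ.* (a ℕ.* b) ℕ.≤_) (≡.sym (square-of-sum a b)) (ℕ.m≤m+n _ _)

  4*ab<[a+b]² : ∀ {a b} → a ≢ b → 4 ℕ.* (a ℕ.* b) ℕ.< (a ℕ.+ b) ℕ.* (a ℕ.+ b)
  4*ab<[a+b]² {a} {b} a≢b with ∣ a - b ∣ in ∣a-b∣≡d | square-of-sum a b
  ... | zero  | _  = ⊥-elim (a≢b (ℕ.∣m-n∣≡0⇒m≡n ∣a-b∣≡d))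
  ... | suc d | eq = subst (4 ℕ.* (a ℕ.* b) ℕ.<_) (≡.sym eq)
                       (ℕ.≤-trans (ℕ.≤-reflexive (ℕ.+-comm 1 _)) (ℕ.+-monoʳ-≤ (4 ℕ.* (a ℕ.* b)) (s≤s z≤n)))

  half-double : ∀ a → (a ℕ.+ a) ℕ./ 2 ≡ a
  half-double a = trans (cong (ℕ._/ 2) (solve 1 (λ a → a :+ a := a :* con 2) refl a)) (ℕ.m*n/n≡m a 2)

  half-double+1 : ∀ a → (a ℕ.+ suc a) ℕ./ 2 ≡ a
  half-double+1 a = begin
    (a ℕ.+ suc a) ℕ./ 2      ≡⟨ cong (ℕ._/ 2) (solve 1 (λ a → a :+ (con 1 :+ a) := a :* con 2 :+ con 1) refl a) ⟩
    (a ℕ.* 2 ℕ.+ 1) ℕ./ 2      ≡⟨ ℕ.+-distrib-/ (a ℕ.* 2) 1 (subst (λ r → r ℕ.+ 1 ℕ.< 2) (≡.sym (ℕ.m*n%n≡0 a 2)) (s≤s (s≤s z≤n))) ⟩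
    a ℕ.* 2 ℕ./ 2 ℕ.+ 0        ≡⟨ ℕ.+-identityʳ _ ⟩
    a ℕ.* 2 ℕ./ 2            ≡⟨ ℕ.m*n/n≡m a 2 ⟩
    a                      ∎
    where open ≡-Reasoning

  balanced-≤ : ∀ {a b} → a ℕ.≤ b → b ∸ a ℕ.≤ 1 → a ≡ (a ℕ.+ b) ℕ./ 2
  balanced-≤ {a} {b} a≤b b∸a≤1 with b ∸ a | ℕ.m+[n∸m]≡n a≤b | b∸a≤1
  ... | zero          | refl | _ = ≡.sym (trans (cong (λ z → (a ℕ.+ z) ℕ./ 2) (ℕ.+-identityʳ a)) (half-double a))
  ... | suc zero      | refl | _ = ≡.sym (trans (cong (λ z → (a ℕ.+ z) ℕ./ 2) (ℕ.+-comm a 1)) (half-double+1 a))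
  ... | suc (suc _)   | refl | s≤s ()

  d*d≤1⇒d≤1 : ∀ {d} → d ℕ.* d ℕ.≤ 1 → d ℕ.≤ 1
  d*d≤1⇒d≤1 {zero}        _ = z≤n
  d*d≤1⇒d≤1 {suc zero}    _ = s≤s z≤n
  d*d≤1⇒d≤1 {suc (suc d)} (s≤s ())

  [a+b]²≤4ab+1⇒balanced : ∀ a b → (a ℕ.+ b) ℕ.* (a ℕ.+ b) ℕ.≤ 4 ℕ.* (a ℕ.* b) ℕ.+ 1 → a ≡ (a ℕ.+ b) ℕ./ 2 ⊎ b ≡ (a ℕ.+ b) ℕ./ 2
  [a+b]²≤4ab+1⇒balanced a b h with ℕ.≤-total a b
  ... | inj₁ a≤b = inj₁ (balanced-≤ a≤b (subst (ℕ._≤ 1) (ℕ.m≤n⇒∣m-n∣≡n∸m a≤b) ∣a-b∣≤1))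
    where
    ∣a-b∣≤1 : ∣ a - b ∣ ℕ.≤ 1
    ∣a-b∣≤1 = d*d≤1⇒d≤1 (ℕ.+-cancelˡ-≤ (4 ℕ.* (a ℕ.* b)) _ _ (subst (ℕ._≤ 4 ℕ.* (a ℕ.* b) ℕ.+ 1) (square-of-sum a b) h))
  ... | inj₂ b≤a = inj₂ (trans (balanced-≤ b≤a (subst (ℕ._≤ 1) (ℕ.m≤n⇒∣n-m∣≡n∸m b≤a) ∣a-b∣≤1)) (cong (ℕ._/ 2) (ℕ.+-comm b a)))
    where
    ∣a-b∣≤1 : ∣ a - b ∣ ℕ.≤ 1
    ∣a-b∣≤1 = d*d≤1⇒d≤1 (ℕ.+-cancelˡ-≤ (4 ℕ.* (a ℕ.* b)) _ _ (subst (ℕ._≤ 4 ℕ.* (a ℕ.* b) ℕ.+ 1) (square-of-sum a b) h))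

  4*P≤4*c+3⇒P≤c : ∀ {P} c → 4 ℕ.* P ℕ.≤ 4 ℕ.* c ℕ.+ 3 → P ℕ.≤ c
  4*P≤4*c+3⇒P≤c {P} c 4P≤4c+3 = ℕ.≮⇒≥ (λ c<P → ℕ.<⇒≱ 4c+3<4+4c
    (ℕ.≤-trans (ℕ.≤-reflexive (≡.sym (ℕ.*-suc 4 c))) (ℕ.≤-trans (ℕ.*-monoʳ-≤ 4 c<P) 4P≤4c+3)))
    where
    4c+3<4+4c : 4 ℕ.* c ℕ.+ 3 ℕ.< 4 ℕ.+ 4 ℕ.* c
    4c+3<4+4c = ℕ.≤-reflexive (solve 1 (λ c → con 1 :+ (con 4 :* c :+ con 3) := con 4 :+ con 4 :* c) refl c)

  m<c-if-4*P≤4*c+3 : ∀ {m P} c → m ℕ.< P → 4 ℕ.* P ℕ.≤ 4 ℕ.* c ℕ.+ 3 → m ℕ.< c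
  m<c-if-4*P≤4*c+3 c m<P 4P≤4c+3 = ℕ.<-≤-trans m<P (4*P≤4*c+3⇒P≤c c 4P≤4c+3)

  2*m<P*[n∸2]-large : ∀ {m P} n → m ℕ.< P → 4 ℕ.≤ n → 2 ℕ.* m ℕ.< P ℕ.* (n ∸ 2)
  2*m<P*[n∸2]-large {m} {P} n m<P 4≤n = ℕ.<-≤-trans (ℕ.*-monoʳ-< 2 m<P)
    (ℕ.≤-trans (ℕ.≤-reflexive (ℕ.*-comm 2 P)) (ℕ.*-monoʳ-≤ P (ℕ.∸-monoˡ-≤ 2 4≤n)))

  2*m≤P*[n∸2] : ∀ {m P} n → m ℕ.< P → 4 ℕ.* P ℕ.≤ n ℕ.* n → 2 ℕ.* m ℕ.≤ P ℕ.* (n ∸ 2)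
  2*m≤P*[n∸2] 0 m<P 4P≤n² = ⊥-elim (ℕ.n≮0 (m<c-if-4*P≤4*c+3 0 m<P (ℕ.≤-trans 4P≤n² z≤n)))
  2*m≤P*[n∸2] 1 m<P 4P≤n² = ⊥-elim (ℕ.n≮0 (m<c-if-4*P≤4*c+3 0 m<P (ℕ.≤-trans 4P≤n² (s≤s z≤n))))
  2*m≤P*[n∸2] {zero} (suc (suc n)) _ _ = z≤n
  2*m≤P*[n∸2] {suc m} 2 m<P 4P≤n² = ⊥-elim (ℕ.n≮0 (ℕ.≤-pred (m<c-if-4*P≤4*c+3 1 m<P (ℕ.≤-trans 4P≤n² (ℕ.m≤m+n 4 3)))))
  2*m≤P*[n∸2] {suc zero} {P} 3 m<P _ = ℕ.≤-trans m<P (ℕ.≤-reflexive (≡.sym (ℕ.*-identityʳ P)))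
  2*m≤P*[n∸2] {suc (suc m)} 3 m<P 4P≤n² =
    ⊥-elim (ℕ.n≮0 (ℕ.≤-pred (ℕ.≤-pred (m<c-if-4*P≤4*c+3 2 m<P (ℕ.≤-trans 4P≤n² (ℕ.m≤m+n 9 2))))))
  2*m≤P*[n∸2] {suc _} n@(suc (suc (suc (suc _)))) m<P _ = ℕ.<⇒≤ (2*m<P*[n∸2]-large n m<P (s≤s (s≤s (s≤s (s≤s z≤n)))))

  2*m<P*[n∸2] : ∀ {m P} n → m ℕ.< P → 4 ℕ.* P ℕ.≤ n ℕ.* n → n ℕ.≤ m ℕ.+ m → 2 ℕ.* m ℕ.< P ℕ.* (n ∸ 2)
  2*m<P*[n∸2] 0 m<P 4P≤n² _ = ⊥-elim (ℕ.n≮0 (m<c-if-4*P≤4*c+3 0 m<P (ℕ.≤-trans 4P≤n² z≤n)))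
  2*m<P*[n∸2] 1 m<P 4P≤n² _ = ⊥-elim (ℕ.n≮0 (m<c-if-4*P≤4*c+3 0 m<P (ℕ.≤-trans 4P≤n² (s≤s z≤n))))
  2*m<P*[n∸2] {zero} 2 _ _ ()
  2*m<P*[n∸2] {suc m} 2 m<P 4P≤n² _ = ⊥-elim (ℕ.n≮0 (ℕ.≤-pred (m<c-if-4*P≤4*c+3 1 m<P (ℕ.≤-trans 4P≤n² (ℕ.m≤m+n 4 3)))))
  2*m<P*[n∸2] {zero} 3 _ _ ()
  2*m<P*[n∸2] {suc zero} 3 _ _ (s≤s (s≤s ()))
  2*m<P*[n∸2] {suc (suc m)} 3 m<P 4P≤n² _ =
    ⊥-elim (ℕ.n≮0 (ℕ.≤-pred (ℕ.≤-pred (m<c-if-4*P≤4*c+3 2 m<P (ℕ.≤-trans 4P≤n² (ℕ.m≤m+n 9 2))))))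
  2*m<P*[n∸2] n@(suc (suc (suc (suc _)))) m<P _ _ = 2*m<P*[n∸2]-large n m<P (s≤s (s≤s (s≤s (s≤s z≤n))))

  -- With P = m + j and P k = 2m + r, the gap between the two sides is j r = (P − m)(P k − 2m).
  gap-identity : ∀ m j k r → (m ℕ.+ j) ℕ.* k ≡ 2 ℕ.* m ℕ.+ r →
    m ℕ.* (k ℕ.+ 2) ℕ.* (m ℕ.+ j) ℕ.+ j ℕ.* r ≡ (m ℕ.+ j) ℕ.* (m ℕ.+ j) ℕ.* k ℕ.+ 2 ℕ.* m ℕ.* m
  gap-identity m j k r Pk≡2m+r = begin
    m ℕ.* (k ℕ.+ 2) ℕ.* P ℕ.+ j ℕ.* r           ≡⟨ solve 4 (λ m j k r → m :* (k :+ con 2) :* (m :+ j) :+ j :* r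
                                                        := m :* ((m :+ j) :* k) :+ con 2 :* m :* (m :+ j) :+ j :* r) refl m j k r ⟩
    m ℕ.* (P ℕ.* k) ℕ.+ 2 ℕ.* m ℕ.* P ℕ.+ j ℕ.* r ≡⟨ cong (λ z → m ℕ.* z ℕ.+ 2 ℕ.* m ℕ.* P ℕ.+ j ℕ.* r) Pk≡2m+r ⟩
    m ℕ.* (2 ℕ.* m ℕ.+ r) ℕ.+ 2 ℕ.* m ℕ.* P ℕ.+ j ℕ.* r ≡⟨ solve 3 (λ m j r → m :* (con 2 :* m :+ r) :+ con 2 :* m :* (m :+ j) :+ j :* r
                                                        := (m :+ j) :* (con 2 :* m :+ r) :+ con 2 :* m :* m) refl m j r ⟩
    P ℕ.* (2 ℕ.* m ℕ.+ r) ℕ.+ 2 ℕ.* m ℕ.* m      ≡⟨ cong (λ z → P ℕ.* z ℕ.+ 2 ℕ.* m ℕ.* m) Pk≡2m+r ⟨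
    P ℕ.* (P ℕ.* k) ℕ.+ 2 ℕ.* m ℕ.* m            ≡⟨ cong (ℕ._+ 2 ℕ.* m ℕ.* m) (ℕ.*-assoc P P k) ⟨
    P ℕ.* P ℕ.* k ℕ.+ 2 ℕ.* m ℕ.* m              ∎
    where
    open ≡-Reasoning
    P = m ℕ.+ j

  gap : ∀ {m P k} → m ℕ.≤ P → 2 ℕ.* m ℕ.≤ P ℕ.* k →
    m ℕ.* (k ℕ.+ 2) ℕ.* P ℕ.+ (P ∸ m) ℕ.* (P ℕ.* k ∸ 2 ℕ.* m) ≡ P ℕ.* P ℕ.* k ℕ.+ 2 ℕ.* m ℕ.* m
  gap {m} {P} {k} m≤P 2m≤Pk with P ∸ m | ℕ.m+[n∸m]≡n m≤P
  ... | j | refl = gap-identity m j k _ (≡.sym (ℕ.m+[n∸m]≡n 2m≤Pk))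

  m*n*P≤P*P*[n∸2]+2*m*m : ∀ {m P} n → m ℕ.≤ P → 4 ℕ.* P ℕ.≤ n ℕ.* n → 2 ℕ.≤ n →
    m ℕ.* n ℕ.* P ℕ.≤ P ℕ.* P ℕ.* (n ∸ 2) ℕ.+ 2 ℕ.* m ℕ.* m
  m*n*P≤P*P*[n∸2]+2*m*m {m} {P} n m≤P 4P≤n² 2≤n with ℕ.m≤n⇒m<n∨m≡n m≤P
  ... | inj₂ refl = ℕ.≤-reflexive (subst (λ x → m ℕ.* x ℕ.* m ≡ m ℕ.* m ℕ.* (n ∸ 2) ℕ.+ 2 ℕ.* m ℕ.* m) (ℕ.m∸n+n≡m 2≤n)
    (solve 2 (λ m k → m :* (k :+ con 2) :* m := m :* m :* k :+ con 2 :* m :* m) refl m (n ∸ 2)))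
  ... | inj₁ m<P = subst (λ x → m ℕ.* x ℕ.* P ℕ.≤ P ℕ.* P ℕ.* (n ∸ 2) ℕ.+ 2 ℕ.* m ℕ.* m) (ℕ.m∸n+n≡m 2≤n)
    (subst (m ℕ.* (n ∸ 2 ℕ.+ 2) ℕ.* P ℕ.≤_) (gap m≤P (2*m≤P*[n∸2] n m<P 4P≤n²)) (ℕ.m≤m+n _ _))

  m*n*P<P*P*[n∸2]+2*m*m : ∀ {m P} n → m ℕ.< P → 2 ℕ.* m ℕ.< P ℕ.* (n ∸ 2) → 2 ℕ.≤ n →
    m ℕ.* n ℕ.* P ℕ.< P ℕ.* P ℕ.* (n ∸ 2) ℕ.+ 2 ℕ.* m ℕ.* m
  m*n*P<P*P*[n∸2]+2*m*m {m} {P} n m<P 2m<Pk 2≤n = subst (λ x → m ℕ.* x ℕ.* P ℕ.< P ℕ.* P ℕ.* (n ∸ 2) ℕ.+ 2 ℕ.* m ℕ.* m) (ℕ.m∸n+n≡m 2≤n)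
    (subst (m ℕ.* (n ∸ 2 ℕ.+ 2) ℕ.* P ℕ.<_) (gap (ℕ.<⇒≤ m<P) (ℕ.<⇒≤ 2m<Pk))
      (ℕ.≤-trans (ℕ.≤-reflexive (ℕ.+-comm 1 _)) (ℕ.+-monoʳ-≤ _ (ℕ.*-mono-≤ (ℕ.m<n⇒0<n∸m m<P) (ℕ.m<n⇒0<n∸m 2m<Pk)))))

  n*n≤4*P+1 : ∀ {P N} n → (2 ℕ.≤ n → 1 ℕ.≤ P) → (n ∸ 2) ℕ.* (n ℕ.* n ∸ 1) ℕ.≤ N → N ℕ.≤ 4 ℕ.* (P ℕ.* (n ∸ 2)) →
    n ℕ.* n ℕ.≤ 4 ℕ.* P ℕ.+ 1
  n*n≤4*P+1 zero                _ _ _ = z≤n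
  n*n≤4*P+1 (suc zero)          _ _ _ = ℕ.m≤n+m 1 _
  n*n≤4*P+1 {P} (suc (suc zero)) 1≤P _ _ = ℕ.≤-trans (ℕ.*-monoʳ-≤ 4 (1≤P (s≤s (s≤s z≤n)))) (ℕ.m≤m+n (4 ℕ.* P) 1)
  n*n≤4*P+1 {P} n@(suc (suc (suc k))) _ lo up = ℕ.≤-trans (ℕ.≤-reflexive (≡.sym (ℕ.m∸n+n≡m {n ℕ.* n} {1} (s≤s z≤n))))
    (ℕ.+-monoˡ-≤ 1 (ℕ.*-cancelˡ-≤ (suc k) (ℕ.≤-trans lo (ℕ.≤-trans up (ℕ.≤-reflexive
      (solve 2 (λ P k → con 4 :* (P :* k) := k :* (con 4 :* P)) refl P (suc k)))))))

  even⇒n≡h+h : ∀ n → 2 ∣ n → n ≡ n ℕ./ 2 ℕ.+ n ℕ./ 2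
  even⇒n≡h+h n (divides q n≡q*2) = trans n≡q*2 (trans (cong (ℕ._* 2) (≡.sym n/2≡q)) (solve 1 (λ x → x :* con 2 := x :+ x) refl (n ℕ./ 2)))
    where
    n/2≡q : n ℕ./ 2 ≡ q
    n/2≡q = trans (cong (ℕ._/ 2) n≡q*2) (ℕ.m*n/n≡m q 2)

  odd⇒n≡1+h+h : ∀ n → ¬ (2 ∣ n) → n ≡ suc (n ℕ./ 2 ℕ.+ n ℕ./ 2)
  odd⇒n≡1+h+h n odd = trans (ℕ.m≡m%n+[m/n]*n n 2)
    (trans (cong (ℕ._+ n ℕ./ 2 ℕ.* 2) n%2≡1) (solve 1 (λ x → con 1 :+ x :* con 2 := con 1 :+ (x :+ x)) refl (n ℕ./ 2)))
    where
    n%2≡1 : n ℕ.% 2 ≡ 1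
    n%2≡1 with n ℕ.% 2 in n%2≡r | ℕ.m%n<n n 2
    ... | zero        | _ = ⊥-elim (odd (divides (n ℕ./ 2) (trans (ℕ.m≡m%n+[m/n]*n n 2) (cong (ℕ._+ n ℕ./ 2 ℕ.* 2) n%2≡r))))
    ... | suc zero    | _ = refl
    ... | suc (suc _) | s≤s (s≤s ())

  4*a*b*[n∸2]≤n*n*[n∸2] : ∀ {a b} n → a ℕ.+ b ≡ n → 4 ℕ.* (a ℕ.* b ℕ.* (n ∸ 2)) ℕ.≤ n ℕ.* n ℕ.* (n ∸ 2)
  4*a*b*[n∸2]≤n*n*[n∸2] {a} {b} n a+b≡n = subst₂ ℕ._≤_ (ℕ.*-assoc 4 (a ℕ.* b) (n ∸ 2)) (cong (λ z → z ℕ.* z ℕ.* (n ∸ 2)) a+b≡n)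
    (ℕ.*-monoˡ-≤ (n ∸ 2) (4*ab≤[a+b]² a b))

  4*a*b*[n∸2]≤[n∸2]*[n*n∸1] : ∀ {a b} n → ¬ (2 ∣ n) → a ℕ.+ b ≡ n → 4 ℕ.* (a ℕ.* b ℕ.* (n ∸ 2)) ℕ.≤ (n ∸ 2) ℕ.* (n ℕ.* n ∸ 1)
  4*a*b*[n∸2]≤[n∸2]*[n*n∸1] {a} {b} n odd a+b≡n = subst (ℕ._≤ (n ∸ 2) ℕ.* (n ℕ.* n ∸ 1))
    (solve 3 (λ a b k → k :* (con 4 :* (a :* b)) := con 4 :* (a :* b :* k)) refl a b (n ∸ 2))
    (ℕ.*-monoʳ-≤ (n ∸ 2) 4ab≤n²∸1)
    where
    a≢b : a ≢ b
    a≢b refl = odd (divides a (trans (≡.sym a+b≡n) (solve 1 (λ a → a :+ a := a :* con 2) refl a)))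
    4ab≤n²∸1 : 4 ℕ.* (a ℕ.* b) ℕ.≤ n ℕ.* n ∸ 1
    4ab≤n²∸1 = ℕ.≤-trans (ℕ.≤-reflexive (≡.sym (ℕ.m+n∸n≡m (4 ℕ.* (a ℕ.* b)) 1)))
      (ℕ.∸-monoˡ-≤ 1 (ℕ.≤-trans (ℕ.≤-reflexive (ℕ.+-comm (4 ℕ.* (a ℕ.* b)) 1))
        (subst (λ z → 4 ℕ.* (a ℕ.* b) ℕ.< z ℕ.* z) a+b≡n (4*ab<[a+b]² a≢b))))

  [n∸2]*[n*n∸1]≤n*n*[n∸2] : ∀ n → (n ∸ 2) ℕ.* (n ℕ.* n ∸ 1) ℕ.≤ n ℕ.* n ℕ.* (n ∸ 2)
  [n∸2]*[n*n∸1]≤n*n*[n∸2] n = ℕ.≤-trans (ℕ.*-monoʳ-≤ (n ∸ 2) (ℕ.m∸n≤m (n ℕ.* n) 1)) (ℕ.≤-reflexive (ℕ.*-comm (n ∸ 2) (n ℕ.* n)))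

  n*n*[n∸2]≡4*⌊n/2⌋*⌈n/2⌉*[n∸2] : ∀ n → 2 ∣ n → n ℕ.* n ℕ.* (n ∸ 2) ≡ 4 ℕ.* (n ℕ./ 2 ℕ.* (n ∸ n ℕ./ 2) ℕ.* (n ∸ 2))
  n*n*[n∸2]≡4*⌊n/2⌋*⌈n/2⌉*[n∸2] n even = begin
    n ℕ.* n ℕ.* (n ∸ 2)                    ≡⟨ cong (λ z → z ℕ.* z ℕ.* (n ∸ 2)) n≡h+h ⟩
    (h ℕ.+ h) ℕ.* (h ℕ.+ h) ℕ.* (n ∸ 2)    ≡⟨ solve 2 (λ h k → (h :+ h) :* (h :+ h) :* k := con 4 :* (h :* h :* k)) refl h (n ∸ 2) ⟩
    4 ℕ.* (h ℕ.* h ℕ.* (n ∸ 2))            ≡⟨ cong (λ z → 4 ℕ.* (h ℕ.* z ℕ.* (n ∸ 2))) n∸h≡h ⟨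
    4 ℕ.* (h ℕ.* (n ∸ h) ℕ.* (n ∸ 2))      ∎
    where
    open ≡-Reasoning
    h = n ℕ./ 2
    n≡h+h : n ≡ h ℕ.+ h
    n≡h+h = even⇒n≡h+h n even
    n∸h≡h : n ∸ h ≡ h
    n∸h≡h = trans (cong (_∸ h) n≡h+h) (ℕ.m+n∸m≡n h h)

  [n∸2]*[n*n∸1]≡4*⌊n/2⌋*⌈n/2⌉*[n∸2] : ∀ n → ¬ (2 ∣ n) → (n ∸ 2) ℕ.* (n ℕ.* n ∸ 1) ≡ 4 ℕ.* (n ℕ./ 2 ℕ.* (n ∸ n ℕ./ 2) ℕ.* (n ∸ 2))
  [n∸2]*[n*n∸1]≡4*⌊n/2⌋*⌈n/2⌉*[n∸2] n odd = begin
    (n ∸ 2) ℕ.* (n ℕ.* n ∸ 1)               ≡⟨ ℕ.*-comm (n ∸ 2) (n ℕ.* n ∸ 1) ⟩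
    (n ℕ.* n ∸ 1) ℕ.* (n ∸ 2)               ≡⟨ cong (ℕ._* (n ∸ 2)) n*n∸1≡4h[h+1] ⟩
    4 ℕ.* (h ℕ.* suc h) ℕ.* (n ∸ 2)         ≡⟨ ℕ.*-assoc 4 (h ℕ.* suc h) (n ∸ 2) ⟩
    4 ℕ.* (h ℕ.* suc h ℕ.* (n ∸ 2))         ≡⟨ cong (λ z → 4 ℕ.* (h ℕ.* z ℕ.* (n ∸ 2))) n∸h≡h+1 ⟨
    4 ℕ.* (h ℕ.* (n ∸ h) ℕ.* (n ∸ 2))       ∎
    where
    open ≡-Reasoning
    h = n ℕ./ 2
    n≡1+h+h : n ≡ suc (h ℕ.+ h)
    n≡1+h+h = odd⇒n≡1+h+h n odd
    n∸h≡h+1 : n ∸ h ≡ suc h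
    n∸h≡h+1 = trans (cong (_∸ h) (trans n≡1+h+h (≡.sym (ℕ.+-suc h h)))) (ℕ.m+n∸m≡n h (suc h))
    n*n∸1≡4h[h+1] : n ℕ.* n ∸ 1 ≡ 4 ℕ.* (h ℕ.* suc h)
    n*n∸1≡4h[h+1] = trans (cong (λ z → z ℕ.* z ∸ 1) n≡1+h+h)
      (trans (cong (_∸ 1) (solve 1 (λ h → (con 1 :+ (h :+ h)) :* (con 1 :+ (h :+ h)) := con 4 :* (h :* (con 1 :+ h)) :+ con 1) refl h))
             (ℕ.m+n∸n≡m (4 ℕ.* (h ℕ.* suc h)) 1))

open ℚ-Solver.+-*-Solver

-- Rational arithmetic

ℕ→ℚ-toℚᵘ : ∀ k → toℚᵘ (ℕ→ℚ k) ≡ ℚᵘ.mkℚᵘ (+ k) 0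
ℕ→ℚ-toℚᵘ k = cong toℚᵘ (ℚ.normalize-coprime (coprime-sym (1-coprimeTo k)))

ℕ→ℚ-+ : ∀ a b → ℕ→ℚ (a ℕ.+ b) ≡ ℕ→ℚ a + ℕ→ℚ b
ℕ→ℚ-+ a b = ℚ.toℚᵘ-injective (begin
  toℚᵘ (ℕ→ℚ (a ℕ.+ b))                  ≡⟨ ℕ→ℚ-toℚᵘ (a ℕ.+ b) ⟩
  ℚᵘ.mkℚᵘ (+ (a ℕ.+ b)) 0               ≈⟨ ℚᵘ.*≡* (cong (ℤ._* + 1) (≡.sym (cong₂ ℤ._+_ (ℤ.*-identityʳ (+ a)) (ℤ.*-identityʳ (+ b))))) ⟩
  ℚᵘ.mkℚᵘ (+ a) 0 ℚᵘ.+ ℚᵘ.mkℚᵘ (+ b) 0  ≡⟨ ≡.sym (cong₂ ℚᵘ._+_ (ℕ→ℚ-toℚᵘ a) (ℕ→ℚ-toℚᵘ b)) ⟩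
  toℚᵘ (ℕ→ℚ a) ℚᵘ.+ toℚᵘ (ℕ→ℚ b)        ≈⟨ ℚᵘ.≃-sym (ℚ.toℚᵘ-homo-+ (ℕ→ℚ a) (ℕ→ℚ b)) ⟩
  toℚᵘ (ℕ→ℚ a + ℕ→ℚ b)                  ∎)
  where open ℚᵘ.≃-Reasoning

ℕ→ℚ-* : ∀ a b → ℕ→ℚ (a ℕ.* b) ≡ ℕ→ℚ a * ℕ→ℚ b
ℕ→ℚ-* a b = ℚ.toℚᵘ-injective (begin
  toℚᵘ (ℕ→ℚ (a ℕ.* b))                  ≡⟨ ℕ→ℚ-toℚᵘ (a ℕ.* b) ⟩
  ℚᵘ.mkℚᵘ (+ (a ℕ.* b)) 0               ≈⟨ ℚᵘ.*≡* (cong (ℤ._* + 1) (ℤ.pos-* a b)) ⟩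
  ℚᵘ.mkℚᵘ (+ a) 0 ℚᵘ.* ℚᵘ.mkℚᵘ (+ b) 0  ≡⟨ ≡.sym (cong₂ ℚᵘ._*_ (ℕ→ℚ-toℚᵘ a) (ℕ→ℚ-toℚᵘ b)) ⟩
  toℚᵘ (ℕ→ℚ a) ℚᵘ.* toℚᵘ (ℕ→ℚ b)        ≈⟨ ℚᵘ.≃-sym (ℚ.toℚᵘ-homo-* (ℕ→ℚ a) (ℕ→ℚ b)) ⟩
  toℚᵘ (ℕ→ℚ a * ℕ→ℚ b)                  ∎)
  where open ℚᵘ.≃-Reasoning

ℕ→ℚ-mono-≤ : ∀ {a b} → a ℕ.≤ b → ℕ→ℚ a ≤ ℕ→ℚ b
ℕ→ℚ-mono-≤ {a} {b} a≤b = ℚ.toℚᵘ-cancel-≤ (subst₂ ℚᵘ._≤_ (≡.sym (ℕ→ℚ-toℚᵘ a)) (≡.sym (ℕ→ℚ-toℚᵘ b))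
  (ℚᵘ.*≤* (subst₂ ℤ._≤_ (≡.sym (ℤ.*-identityʳ (+ a))) (≡.sym (ℤ.*-identityʳ (+ b))) (ℤ.+≤+ a≤b))))

ℕ→ℚ-cancel-≤ : ∀ {a b} → ℕ→ℚ a ≤ ℕ→ℚ b → a ℕ.≤ b
ℕ→ℚ-cancel-≤ {a} {b} a≤b with subst₂ ℚᵘ._≤_ (ℕ→ℚ-toℚᵘ a) (ℕ→ℚ-toℚᵘ b) (ℚ.toℚᵘ-mono-≤ a≤b)
... | ℚᵘ.*≤* a*1≤b*1 = ℤ.drop‿+≤+ (subst₂ ℤ._≤_ (ℤ.*-identityʳ (+ a)) (ℤ.*-identityʳ (+ b)) a*1≤b*1)

ℕ→ℚ-mono-< : ∀ {a b} → a ℕ.< b → ℕ→ℚ a < ℕ→ℚ b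
ℕ→ℚ-mono-< {a} {b} a<b = ℚ.toℚᵘ-cancel-< (subst₂ ℚᵘ._<_ (≡.sym (ℕ→ℚ-toℚᵘ a)) (≡.sym (ℕ→ℚ-toℚᵘ b))
  (ℚᵘ.*<* (subst₂ ℤ._<_ (≡.sym (ℤ.*-identityʳ (+ a))) (≡.sym (ℤ.*-identityʳ (+ b))) (ℤ.+<+ a<b))))

ℕ→ℚ-injective : ∀ {a b} → ℕ→ℚ a ≡ ℕ→ℚ b → a ≡ b
ℕ→ℚ-injective eq = ℕ.≤-antisym (ℕ→ℚ-cancel-≤ (ℚ.≤-reflexive eq)) (ℕ→ℚ-cancel-≤ (ℚ.≤-reflexive (≡.sym eq)))

ℕ→ℚ-nonNeg : ∀ k → 0ℚ ≤ ℕ→ℚ k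
ℕ→ℚ-nonNeg k = ℕ→ℚ-mono-≤ {0} {k} z≤n

ℕ→ℚ-pos : ∀ {k} → 1 ℕ.≤ k → 0ℚ < ℕ→ℚ k
ℕ→ℚ-pos = ℕ→ℚ-mono-< {0}

/4-toℚᵘ : ∀ N → toℚᵘ (+ N / 4) ℚᵘ.≃ ℚᵘ.mkℚᵘ (+ N) 3
/4-toℚᵘ N = ℚ.toℚᵘ-fromℚᵘ (ℚᵘ.mkℚᵘ (+ N) 3)

4*-toℤ : ∀ a → + a ℤ.* + 4 ≡ + (4 ℕ.* a)
4*-toℤ a = trans (≡.sym (ℤ.pos-* a 4)) (cong +_ (ℕ.*-comm a 4))

ℕ→ℚ≤/4 : ∀ a N → 4 ℕ.* a ℕ.≤ N → ℕ→ℚ a ≤ + N / 4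
ℕ→ℚ≤/4 a N 4a≤N = ℚ.toℚᵘ-cancel-≤ (ℚᵘ.≤-respʳ-≃ (ℚᵘ.≃-sym (/4-toℚᵘ N))
  (subst (ℚᵘ._≤ ℚᵘ.mkℚᵘ (+ N) 3) (≡.sym (ℕ→ℚ-toℚᵘ a))
    (ℚᵘ.*≤* (subst₂ ℤ._≤_ (≡.sym (4*-toℤ a)) (≡.sym (ℤ.*-identityʳ (+ N))) (ℤ.+≤+ 4a≤N)))))

/4≤ℕ→ℚ : ∀ a N → N ℕ.≤ 4 ℕ.* a → + N / 4 ≤ ℕ→ℚ a
/4≤ℕ→ℚ a N N≤4a = ℚ.toℚᵘ-cancel-≤ (ℚᵘ.≤-respˡ-≃ (ℚᵘ.≃-sym (/4-toℚᵘ N))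
  (subst (ℚᵘ.mkℚᵘ (+ N) 3 ℚᵘ.≤_) (≡.sym (ℕ→ℚ-toℚᵘ a))
    (ℚᵘ.*≤* (subst₂ ℤ._≤_ (≡.sym (ℤ.*-identityʳ (+ N))) (≡.sym (4*-toℤ a)) (ℤ.+≤+ N≤4a)))))

/4≤ℕ→ℚ⇒ : ∀ a N → + N / 4 ≤ ℕ→ℚ a → N ℕ.≤ 4 ℕ.* a
/4≤ℕ→ℚ⇒ a N N/4≤a
  with subst (ℚᵘ.mkℚᵘ (+ N) 3 ℚᵘ.≤_) (ℕ→ℚ-toℚᵘ a) (ℚᵘ.≤-respˡ-≃ (/4-toℚᵘ N) (ℚ.toℚᵘ-mono-≤ N/4≤a))
... | ℚᵘ.*≤* N*1≤a*4 = ℤ.drop‿+≤+ (subst₂ ℤ._≤_ (ℤ.*-identityʳ (+ N)) (4*-toℤ a) N*1≤a*4)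

*-monoˡ-≤ : ∀ {r p q} → 0ℚ ≤ r → p ≤ q → r * p ≤ r * q
*-monoˡ-≤ {r} 0≤r = ℚ.*-monoˡ-≤-nonNeg r {{nonNegative 0≤r}}

*-monoʳ-≤ : ∀ {r p q} → 0ℚ ≤ r → p ≤ q → p * r ≤ q * r
*-monoʳ-≤ {r} 0≤r = ℚ.*-monoʳ-≤-nonNeg r {{nonNegative 0≤r}}

*-mono-≤ : ∀ {a b c d} → 0ℚ ≤ a → 0ℚ ≤ c → a ≤ b → c ≤ d → a * c ≤ b * d
*-mono-≤ 0≤a 0≤c a≤b c≤d = ℚ.≤-trans (*-monoʳ-≤ 0≤c a≤b) (*-monoˡ-≤ (ℚ.≤-trans 0≤a a≤b) c≤d)

*-monoˡ-< : ∀ {r p q} → 0ℚ < r → p < q → r * p < r * q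
*-monoˡ-< {r} 0<r = ℚ.*-monoʳ-<-pos r {{positive 0<r}}

*-cancelˡ-≤ : ∀ {r p q} → 0ℚ < r → r * p ≤ r * q → p ≤ q
*-cancelˡ-≤ {r} 0<r = ℚ.*-cancelˡ-≤-pos r {{positive 0<r}}

*-cancelˡ-< : ∀ {r p q} → 0ℚ ≤ r → r * p < r * q → p < q
*-cancelˡ-< {r} 0≤r = ℚ.*-cancelˡ-<-nonNeg r {{nonNegative 0≤r}}

*-nonNeg : ∀ {a b} → 0ℚ ≤ a → 0ℚ ≤ b → 0ℚ ≤ a * b
*-nonNeg {a} 0≤a 0≤b = subst (_≤ a * _) (ℚ.*-zeroʳ a) (*-monoˡ-≤ 0≤a 0≤b)

*-pos : ∀ {a b} → 0ℚ < a → 0ℚ < b → 0ℚ < a * b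
*-pos {a} 0<a 0<b = subst (_< a * _) (ℚ.*-zeroʳ a) (*-monoˡ-< 0<a 0<b)

+-nonNeg : ∀ {a b} → 0ℚ ≤ a → 0ℚ ≤ b → 0ℚ ≤ a + b
+-nonNeg = ℚ.+-mono-≤

+-pos : ∀ {a b} → 0ℚ < a → 0ℚ < b → 0ℚ < a + b
+-pos = ℚ.+-mono-<

square-nonNeg : ∀ x → 0ℚ ≤ x * x
square-nonNeg x with ℚ.≤-total 0ℚ x
... | inj₁ 0≤x = *-nonNeg 0≤x 0≤x
... | inj₂ x≤0 = subst (0ℚ ≤_) (solve 1 (λ x → (:- x) :* (:- x) := x :* x) refl x)
                   (*-nonNeg (ℚ.neg-antimono-≤ x≤0) (ℚ.neg-antimono-≤ x≤0))

≤-by-difference : ∀ {a b} e → 0ℚ ≤ e → e ≡ b - a → a ≤ b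
≤-by-difference {a} {b} e 0≤e e≡b-a = subst₂ _≤_ (ℚ.+-identityʳ a) a+[b-a]≡b (ℚ.+-monoʳ-≤ a (subst (0ℚ ≤_) e≡b-a 0≤e))
  where
  a+[b-a]≡b : a + (b - a) ≡ b
  a+[b-a]≡b = solve 2 (λ a b → a :+ (b :- a) := b) refl a b

<-by-difference : ∀ {a b} e → 0ℚ < e → e ≡ b - a → a < b
<-by-difference {a} {b} e 0<e e≡b-a = subst₂ _<_ (ℚ.+-identityʳ a) a+[b-a]≡b (ℚ.+-monoʳ-< a (subst (0ℚ <_) e≡b-a 0<e))
  where
  a+[b-a]≡b : a + (b - a) ≡ b
  a+[b-a]≡b = solve 2 (λ a b → a :+ (b :- a) := b) refl a b

≤⇒0≤- : ∀ {a b} → a ≤ b → 0ℚ ≤ b - a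
≤⇒0≤- {a} {b} a≤b = subst (_≤ b - a) (ℚ.+-inverseʳ a) (ℚ.+-monoˡ-≤ (- a) a≤b)

<⇒0<- : ∀ {a b} → a < b → 0ℚ < b - a
<⇒0<- {a} {b} a<b = subst (_< b - a) (ℚ.+-inverseʳ a) (ℚ.+-monoˡ-< (- a) a<b)

+-cancelʳ-≤ : ∀ {a b c} → a + c ≤ b + c → a ≤ b
+-cancelʳ-≤ {a} {b} {c} a+c≤b+c = subst₂ _≤_ (x+c-c≡x a) (x+c-c≡x b) (ℚ.+-monoˡ-≤ (- c) a+c≤b+c)
  where
  x+c-c≡x : ∀ x → x + c - c ≡ x
  x+c-c≡x x = solve 2 (λ x c → x :+ c :- c := x) refl x c

+-cancelʳ-< : ∀ {a b c} → a + c < b + c → a < b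
+-cancelʳ-< {a} {b} {c} a+c<b+c = subst₂ _<_ (x+c-c≡x a) (x+c-c≡x b) (ℚ.+-monoˡ-< (- c) a+c<b+c)
  where
  x+c-c≡x : ∀ x → x + c - c ≡ x
  x+c-c≡x x = solve 2 (λ x c → x :+ c :- c := x) refl x c

x+x≤y+y⇒x≤y : ∀ {x y} → x + x ≤ y + y → x ≤ y
x+x≤y+y⇒x≤y {x} {y} 2x≤2y with x ℚ.≤? y
... | yes x≤y = x≤y
... | no x≰y = ⊥-elim (ℚ.<-irrefl refl (ℚ.≤-<-trans 2x≤2y (ℚ.+-mono-< (ℚ.≰⇒> x≰y) (ℚ.≰⇒> x≰y))))

x*x≤y*y⇒x≤y : ∀ {x y} → 0ℚ ≤ x → 0ℚ ≤ y → x * x ≤ y * y → x ≤ y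
x*x≤y*y⇒x≤y {x} {y} 0≤x 0≤y x²≤y² with x ℚ.≤? y
... | yes x≤y = x≤y
... | no x≰y = ⊥-elim (ℚ.<-irrefl refl (ℚ.≤-<-trans x²≤y² y²<x²))
  where
  y<x : y < x
  y<x = ℚ.≰⇒> x≰y
  y²<x² : y * y < x * x
  y²<x² = ℚ.≤-<-trans (*-monoˡ-≤ 0≤y (ℚ.<⇒≤ y<x)) (ℚ.*-monoˡ-<-pos x {{positive (ℚ.≤-<-trans 0≤y y<x)}} y<x)

recip : (x : ℚ) → 0ℚ < x → ℚ
recip x 0<x = (1/ x) {{>-nonZero 0<x}}

*-recip : ∀ x 0<x → x * recip x 0<x ≡ 1ℚ
*-recip x 0<x = ℚ.*-inverseʳ x {{>-nonZero 0<x}}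

recip-pos : ∀ x 0<x → 0ℚ < recip x 0<x
recip-pos x 0<x = ℚ.positive⁻¹ (recip x 0<x) {{ℚ.1/pos⇒pos x {{positive 0<x}}}}

-- inv 0 = 0 is a junk value; every lemma about inv k that needs it assumes 1 ≤ k.
inv : ℕ → ℚ
inv zero    = 0ℚ
inv (suc k) = recip (ℕ→ℚ (suc k)) (ℕ→ℚ-pos {suc k} (s≤s z≤n))

ℕ→ℚ*inv : ∀ {k} → 1 ℕ.≤ k → ℕ→ℚ k * inv k ≡ 1ℚ
ℕ→ℚ*inv {suc k} _ = *-recip (ℕ→ℚ (suc k)) (ℕ→ℚ-pos {suc k} (s≤s z≤n))

inv-nonNeg : ∀ k → 0ℚ ≤ inv k
inv-nonNeg zero    = ℚ.≤-refl
inv-nonNeg (suc k) = ℚ.<⇒≤ (recip-pos (ℕ→ℚ (suc k)) (ℕ→ℚ-pos {suc k} (s≤s z≤n)))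

ℕ→ℚ*inv≤1 : ∀ k → ℕ→ℚ k * inv k ≤ 1ℚ
ℕ→ℚ*inv≤1 zero    = *≤* (ℤ.+≤+ z≤n)
ℕ→ℚ*inv≤1 (suc k) = ℚ.≤-reflexive (ℕ→ℚ*inv {suc k} (s≤s z≤n))

inverse-unique : ∀ {a x y} → x * a ≡ 1ℚ → a * y ≡ 1ℚ → x ≡ y
inverse-unique {a} {x} {y} xa≡1 ay≡1 = begin
  x            ≡⟨ ≡.sym (ℚ.*-identityʳ x) ⟩
  x * 1ℚ       ≡⟨ cong (x *_) (≡.sym ay≡1) ⟩
  x * (a * y)  ≡⟨ ≡.sym (ℚ.*-assoc x a y) ⟩
  (x * a) * y  ≡⟨ cong (_* y) xa≡1 ⟩
  1ℚ * y       ≡⟨ ℚ.*-identityˡ y ⟩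
  y            ∎
  where open ≡-Reasoning

inv-* : ∀ {j k} → 1 ℕ.≤ j → 1 ℕ.≤ k → inv (j ℕ.* k) ≡ inv j * inv k
inv-* {j} {k} 1≤j 1≤k = inverse-unique {ℕ→ℚ (j ℕ.* k)}
  (trans (ℚ.*-comm (inv (j ℕ.* k)) (ℕ→ℚ (j ℕ.* k))) (ℕ→ℚ*inv {j ℕ.* k} (ℕ.*-mono-≤ 1≤j 1≤k))) (begin
  ℕ→ℚ (j ℕ.* k) * (inv j * inv k)      ≡⟨ cong (_* (inv j * inv k)) (ℕ→ℚ-* j k) ⟩
  ℕ→ℚ j * ℕ→ℚ k * (inv j * inv k)      ≡⟨ solve 4 (λ a b c d → a :* b :* (c :* d) := (a :* c) :* (b :* d)) refl (ℕ→ℚ j) (ℕ→ℚ k) (inv j) (inv k) ⟩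
  (ℕ→ℚ j * inv j) * (ℕ→ℚ k * inv k)    ≡⟨ cong₂ _*_ (ℕ→ℚ*inv 1≤j) (ℕ→ℚ*inv 1≤k) ⟩
  1ℚ * 1ℚ                              ≡⟨ ℚ.*-identityˡ 1ℚ ⟩
  1ℚ                                   ∎)
  where open ≡-Reasoning

inv-antitone : ∀ {j k} → 1 ℕ.≤ j → j ℕ.≤ k → inv k ≤ inv j
inv-antitone {j} {k} 1≤j j≤k = begin
  inv k                        ≡⟨ ≡.sym (ℚ.*-identityʳ (inv k)) ⟩
  inv k * 1ℚ                   ≡⟨ cong (inv k *_) (≡.sym (ℕ→ℚ*inv 1≤j)) ⟩
  inv k * (ℕ→ℚ j * inv j)      ≡⟨ ≡.sym (ℚ.*-assoc (inv k) _ _) ⟩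
  (inv k * ℕ→ℚ j) * inv j      ≤⟨ *-monoʳ-≤ (inv-nonNeg j) (*-monoˡ-≤ (inv-nonNeg k) (ℕ→ℚ-mono-≤ j≤k)) ⟩
  (inv k * ℕ→ℚ k) * inv j      ≡⟨ cong (_* inv j) (trans (ℚ.*-comm (inv k) (ℕ→ℚ k)) (ℕ→ℚ*inv (ℕ.≤-trans 1≤j j≤k))) ⟩
  1ℚ * inv j                   ≡⟨ ℚ.*-identityˡ (inv j) ⟩
  inv j                        ∎
  where open ℚ.≤-Reasoning

≤-*inv : ∀ {x y} k → 1 ℕ.≤ k → x * ℕ→ℚ k ≤ y → x ≤ y * inv k
≤-*inv {x} {y} k 1≤k xk≤y = begin
  x                        ≡⟨ ≡.sym (ℚ.*-identityʳ x) ⟩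
  x * 1ℚ                   ≡⟨ cong (x *_) (≡.sym (ℕ→ℚ*inv 1≤k)) ⟩
  x * (ℕ→ℚ k * inv k)      ≡⟨ ≡.sym (ℚ.*-assoc x _ _) ⟩
  x * ℕ→ℚ k * inv k        ≤⟨ *-monoʳ-≤ (inv-nonNeg k) xk≤y ⟩
  y * inv k                ∎
  where open ℚ.≤-Reasoning

-- Finite sums

module ℚΣ = CommutativeMonoidSum ℚ.+-0-commutativeMonoid
module ℚΣ* = SemiringSum (Ring.semiring ℚ.+-*-ring)
module ℕΣ = CommutativeMonoidSum ℕ.+-0-commutativeMonoid

sumℚ≡sum : ∀ {n} (f : Fin n → ℚ) → sumℚ f ≡ ℚΣ.sum f
sumℚ≡sum {zero}  f = refl
sumℚ≡sum {suc n} f = cong (_+_ (f zero)) (sumℚ≡sum (λ i → f (suc i)))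

sumℕ≡sum : ∀ {n} (f : Fin n → ℕ) → sumℕ f ≡ ℕΣ.sum f
sumℕ≡sum {zero}  f = refl
sumℕ≡sum {suc n} f = cong (f zero ℕ.+_) (sumℕ≡sum (λ i → f (suc i)))

sumℚ-cong : ∀ {n} {f g : Fin n → ℚ} → (∀ i → f i ≡ g i) → sumℚ f ≡ sumℚ g
sumℚ-cong {f = f} {g} f≗g rewrite sumℚ≡sum f | sumℚ≡sum g = ℚΣ.sum-cong-≗ f≗g

sumℚ-+ : ∀ {n} (f g : Fin n → ℚ) → sumℚ (λ i → f i + g i) ≡ sumℚ f + sumℚ g
sumℚ-+ f g rewrite sumℚ≡sum (λ i → f i + g i) | sumℚ≡sum f | sumℚ≡sum g = ℚΣ.∑-distrib-+ f g

sumℚ-*ˡ : ∀ {n} c (f : Fin n → ℚ) → sumℚ (λ i → c * f i) ≡ c * sumℚ f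
sumℚ-*ˡ c f rewrite sumℚ≡sum (λ i → c * f i) | sumℚ≡sum f = ≡.sym (ℚΣ*.*-distribˡ-sum c f)

sumℚ-*ʳ : ∀ {n} (f : Fin n → ℚ) c → sumℚ (λ i → f i * c) ≡ sumℚ f * c
sumℚ-*ʳ f c rewrite sumℚ≡sum (λ i → f i * c) | sumℚ≡sum f = ≡.sym (ℚΣ*.*-distribʳ-sum c f)

sumℚ-comm : ∀ {m n} (f : Fin m → Fin n → ℚ) →
  sumℚ (λ i → sumℚ (λ j → f i j)) ≡ sumℚ (λ j → sumℚ (λ i → f i j))
sumℚ-comm f = begin
  sumℚ (λ i → sumℚ (λ j → f i j))      ≡⟨ sumℚ-cong (λ i → sumℚ≡sum (f i)) ⟩
  sumℚ (λ i → ℚΣ.sum (λ j → f i j))    ≡⟨ sumℚ≡sum (λ i → ℚΣ.sum (λ j → f i j)) ⟩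
  ℚΣ.sum (λ i → ℚΣ.sum (λ j → f i j))  ≡⟨ ℚΣ.∑-comm f ⟩
  ℚΣ.sum (λ j → ℚΣ.sum (λ i → f i j))  ≡⟨ sumℚ≡sum (λ j → ℚΣ.sum (λ i → f i j)) ⟨
  sumℚ (λ j → ℚΣ.sum (λ i → f i j))    ≡⟨ sumℚ-cong (λ j → sumℚ≡sum (λ i → f i j)) ⟨
  sumℚ (λ j → sumℚ (λ i → f i j))      ∎
  where open ≡-Reasoning

sumℚ-mono-≤ : ∀ {n} {f g : Fin n → ℚ} → (∀ i → f i ≤ g i) → sumℚ f ≤ sumℚ g
sumℚ-mono-≤ {zero}  f≤g = ℚ.≤-refl
sumℚ-mono-≤ {suc n} f≤g = ℚ.+-mono-≤ (f≤g zero) (sumℚ-mono-≤ (λ i → f≤g (suc i)))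

sumℚ-nonNeg : ∀ {n} {f : Fin n → ℚ} → (∀ i → 0ℚ ≤ f i) → 0ℚ ≤ sumℚ f
sumℚ-nonNeg {zero}  0≤f = ℚ.≤-refl
sumℚ-nonNeg {suc n} 0≤f = +-nonNeg (0≤f zero) (sumℚ-nonNeg (λ i → 0≤f (suc i)))

sumℚ-ℕ→ℚ : ∀ {n} (f : Fin n → ℕ) → sumℚ (λ i → ℕ→ℚ (f i)) ≡ ℕ→ℚ (sumℕ f)
sumℚ-ℕ→ℚ {zero}  f = refl
sumℚ-ℕ→ℚ {suc n} f = trans (cong (_+_ (ℕ→ℚ (f zero))) (sumℚ-ℕ→ℚ (λ i → f (suc i))))
                            (≡.sym (ℕ→ℚ-+ (f zero) _))

sumℕ-cong : ∀ {n} {f g : Fin n → ℕ} → (∀ i → f i ≡ g i) → sumℕ f ≡ sumℕ g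
sumℕ-cong {f = f} {g} f≗g rewrite sumℕ≡sum f | sumℕ≡sum g = ℕΣ.sum-cong-≗ f≗g

sumℕ-+ : ∀ {n} (f g : Fin n → ℕ) → sumℕ (λ i → f i ℕ.+ g i) ≡ sumℕ f ℕ.+ sumℕ g
sumℕ-+ f g rewrite sumℕ≡sum (λ i → f i ℕ.+ g i) | sumℕ≡sum f | sumℕ≡sum g = ℕΣ.∑-distrib-+ f g

sumℕ-*ʳ : ∀ {n} (f : Fin n → ℕ) c → sumℕ (λ i → f i ℕ.* c) ≡ sumℕ f ℕ.* c
sumℕ-*ʳ {zero}  f c = refl
sumℕ-*ʳ {suc n} f c = trans (cong (f zero ℕ.* c ℕ.+_) (sumℕ-*ʳ (λ i → f (suc i)) c))
                            (≡.sym (ℕ.*-distribʳ-+ c (f zero) _))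

sumℕ-const : ∀ n c → sumℕ {n} (λ _ → c) ≡ n ℕ.* c
sumℕ-const zero    c = refl
sumℕ-const (suc n) c = cong (c ℕ.+_) (sumℕ-const n c)

sumℕ-mono-≤ : ∀ {n} {f g : Fin n → ℕ} → (∀ i → f i ℕ.≤ g i) → sumℕ f ℕ.≤ sumℕ g
sumℕ-mono-≤ {zero}  f≤g = z≤n
sumℕ-mono-≤ {suc n} f≤g = ℕ.+-mono-≤ (f≤g zero) (sumℕ-mono-≤ (λ i → f≤g (suc i)))

≤-sumℕ : ∀ {n} (f : Fin n → ℕ) i → f i ℕ.≤ sumℕ f
≤-sumℕ f zero    = ℕ.m≤m+n _ _
≤-sumℕ f (suc i) = ℕ.≤-trans (≤-sumℕ (λ j → f (suc j)) i) (ℕ.m≤n+m _ (f zero))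

sumℕ-mono-≤-≡ : ∀ {n} {f g : Fin n → ℕ} → (∀ i → f i ℕ.≤ g i) → sumℕ f ≡ sumℕ g → ∀ i → f i ≡ g i
sumℕ-mono-≤-≡ {suc n} {f} {g} f≤g Σf≡Σg = go
  where
  f₀≡g₀ : f zero ≡ g zero
  f₀≡g₀ = ℕ.≤-antisym (f≤g zero) (ℕ.+-cancelʳ-≤ _ _ _
    (ℕ.≤-trans (ℕ.+-monoʳ-≤ (g zero) (sumℕ-mono-≤ (λ j → f≤g (suc j)))) (ℕ.≤-reflexive (≡.sym Σf≡Σg))))
  go : ∀ i → f i ≡ g i
  go zero    = f₀≡g₀
  go (suc i) = sumℕ-mono-≤-≡ (λ j → f≤g (suc j))
    (ℕ.+-cancelˡ-≡ (f zero) _ _ (trans Σf≡Σg (cong (ℕ._+ _) (≡.sym f₀≡g₀)))) i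

-- The summand of deg, so that deg G u ≡ count (adj G u) definitionally.
𝟙 : Bool → ℕ
𝟙 b = if b then 1 else 0

count : ∀ {n} → (Fin n → Bool) → ℕ
count φ = sumℕ (λ i → 𝟙 (φ i))

𝟙-injective : ∀ {a b} → 𝟙 a ≡ 𝟙 b → a ≡ b
𝟙-injective {true}  {true}  _ = refl
𝟙-injective {false} {false} _ = refl

count-+-count-not : ∀ {n} (φ : Fin n → Bool) → count φ ℕ.+ count (λ i → not (φ i)) ≡ n
count-+-count-not {n} φ = begin
  count φ ℕ.+ count (λ i → not (φ i))          ≡⟨ sumℕ-+ (λ i → 𝟙 (φ i)) (λ i → 𝟙 (not (φ i))) ⟨
  sumℕ (λ i → 𝟙 (φ i) ℕ.+ 𝟙 (not (φ i)))      ≡⟨ sumℕ-cong (λ i → 𝟙+𝟙-not (φ i)) ⟩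
  sumℕ {n} (λ _ → 1)                          ≡⟨ sumℕ-const n 1 ⟩
  n ℕ.* 1                                     ≡⟨ ℕ.*-identityʳ n ⟩
  n                                           ∎
  where
  open ≡-Reasoning
  𝟙+𝟙-not : ∀ b → 𝟙 b ℕ.+ 𝟙 (not b) ≡ 1
  𝟙+𝟙-not true  = refl
  𝟙+𝟙-not false = refl

sumℚ-if : ∀ {n} (φ : Fin n → Bool) c → sumℚ (λ i → if φ i then c else 0ℚ) ≡ c * ℕ→ℚ (count φ)
sumℚ-if φ c = begin
  sumℚ (λ i → if φ i then c else 0ℚ)   ≡⟨ sumℚ-cong (λ i → if-as-* (φ i)) ⟩
  sumℚ (λ i → c * ℕ→ℚ (𝟙 (φ i)))      ≡⟨ sumℚ-*ˡ c (λ i → ℕ→ℚ (𝟙 (φ i))) ⟩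
  c * sumℚ (λ i → ℕ→ℚ (𝟙 (φ i)))      ≡⟨ cong (c *_) (sumℚ-ℕ→ℚ (λ i → 𝟙 (φ i))) ⟩
  c * ℕ→ℚ (count φ)                    ∎
  where
  open ≡-Reasoning
  if-as-* : ∀ b → (if b then c else 0ℚ) ≡ c * ℕ→ℚ (𝟙 b)
  if-as-* true  = ≡.sym (ℚ.*-identityʳ c)
  if-as-* false = ≡.sym (ℚ.*-zeroʳ c)

exists-if-count-pos : ∀ {n} (φ : Fin n → Bool) → 1 ℕ.≤ count φ → Σ (Fin n) (λ j → φ j ≡ true)
exists-if-count-pos {suc n} φ 1≤count with φ zero in φ₀
... | true  = zero , φ₀
... | false with exists-if-count-pos (λ i → φ (suc i)) 1≤count
...   | j , φj = suc j , φj

-- Cauchy–Schwarz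

4ℚ : ℚ
4ℚ = ℕ→ℚ 4

am-gm : ∀ {z a b} → 0ℚ ≤ a → 0ℚ ≤ b → z * z ≤ a * b → z + z ≤ a + b
am-gm {z} {a} {b} 0≤a 0≤b z²≤ab with ℚ.≤-total z 0ℚ
... | inj₁ z≤0 = ℚ.≤-trans (ℚ.+-mono-≤ z≤0 z≤0) (+-nonNeg 0≤a 0≤b)
... | inj₂ 0≤z = x*x≤y*y⇒x≤y (+-nonNeg 0≤z 0≤z) (+-nonNeg 0≤a 0≤b) (begin
  (z + z) * (z + z)  ≡⟨ solve 1 (λ z → (z :+ z) :* (z :+ z) := con 4ℚ :* (z :* z)) refl z ⟩
  4ℚ * (z * z)       ≤⟨ *-monoˡ-≤ (ℕ→ℚ-nonNeg 4) z²≤ab ⟩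
  4ℚ * (a * b)       ≤⟨ ≤-by-difference ((a - b) * (a - b)) (square-nonNeg (a - b))
                          (solve 2 (λ a b → (a :- b) :* (a :- b) := (a :+ b) :* (a :+ b) :- con 4ℚ :* (a :* b)) refl a b) ⟩
  (a + b) * (a + b)  ∎)
  where open ℚ.≤-Reasoning

Cauchy–Schwarz-+ : ∀ {a₁ x₁ b₁ a₂ x₂ b₂} → 0ℚ ≤ a₁ → 0ℚ ≤ b₁ → 0ℚ ≤ a₂ → 0ℚ ≤ b₂ →
  x₁ * x₁ ≤ a₁ * b₁ → x₂ * x₂ ≤ a₂ * b₂ → (x₁ + x₂) * (x₁ + x₂) ≤ (a₁ + a₂) * (b₁ + b₂)
Cauchy–Schwarz-+ {a₁} {x₁} {b₁} {a₂} {x₂} {b₂} 0≤a₁ 0≤b₁ 0≤a₂ 0≤b₂ h₁ h₂ =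
  subst₂ _≤_ (solve 2 (λ x y → x :* x :+ y :* y :+ (x :* y :+ x :* y) := (x :+ y) :* (x :+ y)) refl x₁ x₂)
             (solve 4 (λ a b c d → a :* b :+ c :* d :+ (a :* d :+ c :* b) := (a :+ c) :* (b :+ d)) refl a₁ b₁ a₂ b₂)
             (ℚ.+-mono-≤ (ℚ.+-mono-≤ h₁ h₂) cross)
  where
  cross : x₁ * x₂ + x₁ * x₂ ≤ a₁ * b₂ + a₂ * b₁
  cross = am-gm {x₁ * x₂} (*-nonNeg 0≤a₁ 0≤b₂) (*-nonNeg 0≤a₂ 0≤b₁)
    (subst₂ _≤_ (solve 2 (λ x y → (x :* x) :* (y :* y) := (x :* y) :* (x :* y)) refl x₁ x₂)
                (solve 4 (λ a b c d → (a :* b) :* (c :* d) := (a :* d) :* (c :* b)) refl a₁ b₁ a₂ b₂)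
                (*-mono-≤ (square-nonNeg x₁) (square-nonNeg x₂) h₁ h₂))

sumℚ-Cauchy–Schwarz : ∀ {n} (a x b : Fin n → ℚ) → (∀ i → 0ℚ ≤ a i) → (∀ i → 0ℚ ≤ b i) →
  (∀ i → x i * x i ≤ a i * b i) → sumℚ x * sumℚ x ≤ sumℚ a * sumℚ b
sumℚ-Cauchy–Schwarz {zero}  a x b 0≤a 0≤b h = ℚ.≤-refl
sumℚ-Cauchy–Schwarz {suc n} a x b 0≤a 0≤b h =
  Cauchy–Schwarz-+ {x₁ = x zero} {x₂ = sumℚ (λ i → x (suc i))}
    (0≤a zero) (0≤b zero) (sumℚ-nonNeg (λ i → 0≤a (suc i))) (sumℚ-nonNeg (λ i → 0≤b (suc i)))
    (h zero) (sumℚ-Cauchy–Schwarz (λ i → a (suc i)) (λ i → x (suc i)) (λ i → b (suc i))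
                                   (λ i → 0≤a (suc i)) (λ i → 0≤b (suc i)) (λ i → h (suc i)))

-- For nonnegative x and y this says x √c ≤ y √d.
√-scaled-+ : ∀ {c d x₁ y₁ x₂ y₂} → 0ℚ ≤ c → 0ℚ ≤ d → 0ℚ ≤ x₁ → 0ℚ ≤ y₁ → 0ℚ ≤ x₂ → 0ℚ ≤ y₂ →
  x₁ * x₁ * c ≤ y₁ * y₁ * d → x₂ * x₂ * c ≤ y₂ * y₂ * d → (x₁ + x₂) * (x₁ + x₂) * c ≤ (y₁ + y₂) * (y₁ + y₂) * d
√-scaled-+ {c} {d} {x₁} {y₁} {x₂} {y₂} 0≤c 0≤d 0≤x₁ 0≤y₁ 0≤x₂ 0≤y₂ h₁ h₂ =
  subst₂ _≤_ (expand x₁ x₂ c) (expand y₁ y₂ d) (ℚ.+-mono-≤ (ℚ.+-mono-≤ h₁ h₂) (ℚ.+-mono-≤ cross cross))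
  where
  expand : ∀ x y e → x * x * e + y * y * e + (x * y * e + x * y * e) ≡ (x + y) * (x + y) * e
  expand = solve 3 (λ x y e → x :* x :* e :+ y :* y :* e :+ (x :* y :* e :+ x :* y :* e) := (x :+ y) :* (x :+ y) :* e) refl
  regroup : ∀ x y e → (x * x * e) * (y * y * e) ≡ (x * y * e) * (x * y * e)
  regroup = solve 3 (λ x y e → (x :* x :* e) :* (y :* y :* e) := (x :* y :* e) :* (x :* y :* e)) refl
  cross : x₁ * x₂ * c ≤ y₁ * y₂ * d
  cross = x*x≤y*y⇒x≤y (*-nonNeg (*-nonNeg 0≤x₁ 0≤x₂) 0≤c) (*-nonNeg (*-nonNeg 0≤y₁ 0≤y₂) 0≤d)
    (subst₂ _≤_ (regroup x₁ x₂ c) (regroup y₁ y₂ d)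
      (*-mono-≤ (*-nonNeg (square-nonNeg x₁) 0≤c) (*-nonNeg (square-nonNeg x₂) 0≤c) h₁ h₂))

sumℚ-√-scaled : ∀ {n} {c d} (x y : Fin n → ℚ) → 0ℚ ≤ c → 0ℚ ≤ d → (∀ i → 0ℚ ≤ x i) → (∀ i → 0ℚ ≤ y i) →
  (∀ i → x i * x i * c ≤ y i * y i * d) → sumℚ x * sumℚ x * c ≤ sumℚ y * sumℚ y * d
sumℚ-√-scaled {zero}  {c} {d} x y 0≤c 0≤d 0≤x 0≤y h =
  subst₂ _≤_ (≡.sym (ℚ.*-zeroˡ c)) (≡.sym (ℚ.*-zeroˡ d)) ℚ.≤-refl
sumℚ-√-scaled {suc n} x y 0≤c 0≤d 0≤x 0≤y h =
  √-scaled-+ {x₁ = x zero} {y₁ = y zero} {x₂ = sumℚ (λ i → x (suc i))} {y₂ = sumℚ (λ i → y (suc i))}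
    0≤c 0≤d (0≤x zero) (0≤y zero) (sumℚ-nonNeg (λ i → 0≤x (suc i))) (sumℚ-nonNeg (λ i → 0≤y (suc i)))
    (h zero) (sumℚ-√-scaled (λ i → x (suc i)) (λ i → y (suc i)) 0≤c 0≤d
                            (λ i → 0≤x (suc i)) (λ i → 0≤y (suc i)) (λ i → h (suc i)))

-- Rational square roots

archimedean : ∀ x → Σ ℕ λ K → x ≤ ℕ→ℚ K
archimedean (mkℚ (+ k) d _) = k , ℚ.toℚᵘ-cancel-≤ (subst (ℚᵘ.mkℚᵘ (+ k) d ℚᵘ.≤_) (≡.sym (ℕ→ℚ-toℚᵘ k))
  (ℚᵘ.*≤* (ℤ.*-monoˡ-≤-nonNeg (+ k) (ℤ.+≤+ (s≤s (z≤n {d}))))))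
archimedean (mkℚ ℤ.-[1+ k ] d _) = 0 , ℚ.toℚᵘ-cancel-≤ (subst (ℚᵘ.mkℚᵘ ℤ.-[1+ k ] d ℚᵘ.≤_) (≡.sym (ℕ→ℚ-toℚᵘ 0))
  (ℚᵘ.*≤* ℤ.-≤+))

0<1 : 0ℚ < 1ℚ
0<1 = *<* (ℤ.+<+ (s≤s z≤n))

-- Newton's iteration t ↦ (t² + r)/2t from t = r + 1.  Each step at least quarters the excess t² − r,
-- so after k steps (k + 1)(t² − r) is still bounded by the initial excess.
module Newton {r : ℚ} (0≤r : 0ℚ ≤ r) where

  excess₀ : ℚ
  excess₀ = (r + 1ℚ) * (r + 1ℚ) - r

  Approximant : ℕ → ℚ → Set
  Approximant k t = (0ℚ < t) × (r ≤ t * t) × (ℕ→ℚ (suc k) * (t * t - r) ≤ excess₀)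

  newton-step : ∀ {k t} → Approximant k t → Σ ℚ (Approximant (suc k))
  newton-step {k} {t} (0<t , r≤t² , bound) = t′ , 0<t′ , r≤t′² , bound′
    where
    s = recip (t + t) (+-pos 0<t 0<t)
    2ts≡1 : (t + t) * s ≡ 1ℚ
    2ts≡1 = *-recip (t + t) (+-pos 0<t 0<t)
    e = t * t - r
    0≤e : 0ℚ ≤ e
    0≤e = ≤⇒0≤- r≤t²
    t′ = (t * t + r) * s
    0<t′ : 0ℚ < t′
    0<t′ = *-pos (ℚ.<-≤-trans (*-pos 0<t 0<t) (subst (_≤ t * t + r) (ℚ.+-identityʳ (t * t)) (ℚ.+-monoʳ-≤ (t * t) 0≤r)))
                 (recip-pos (t + t) (+-pos 0<t 0<t))
    [2ts]²≡1 : ((t + t) * s) * ((t + t) * s) ≡ 1ℚ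
    [2ts]²≡1 = trans (cong₂ _*_ 2ts≡1 2ts≡1) (ℚ.*-identityˡ 1ℚ)
    excess′ : t′ * t′ - r ≡ (e * s) * (e * s)
    excess′ = begin
      t′ * t′ - r                                      ≡⟨ cong (λ z → t′ * t′ - z) (trans (cong (r *_) [2ts]²≡1) (ℚ.*-identityʳ r)) ⟨
      t′ * t′ - r * (((t + t) * s) * ((t + t) * s))    ≡⟨ solve 3 (λ t r s → ((t :* t :+ r) :* s) :* ((t :* t :+ r) :* s) :- r :* (((t :+ t) :* s) :* ((t :+ t) :* s))
                                                            := ((t :* t :- r) :* s) :* ((t :* t :- r) :* s)) refl t r s ⟩
      (e * s) * (e * s)                                ∎
      where open ≡-Reasoning
    r≤t′² : r ≤ t′ * t′
    r≤t′² = ≤-by-difference ((e * s) * (e * s)) (square-nonNeg (e * s)) (≡.sym excess′)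
    e≤t² : e ≤ t * t
    e≤t² = ≤-by-difference r 0≤r (solve 2 (λ t r → r := t :* t :- (t :* t :- r)) refl t r)
    quartered : 4ℚ * (t′ * t′ - r) ≤ e
    quartered = begin
      4ℚ * (t′ * t′ - r)                   ≡⟨ cong (4ℚ *_) excess′ ⟩
      4ℚ * ((e * s) * (e * s))             ≡⟨ solve 2 (λ e s → con 4ℚ :* ((e :* s) :* (e :* s)) := e :* (e :* (con 4ℚ :* (s :* s)))) refl e s ⟩
      e * (e * (4ℚ * (s * s)))             ≤⟨ *-monoˡ-≤ 0≤e (*-monoʳ-≤ (*-nonNeg (ℕ→ℚ-nonNeg 4) (square-nonNeg s)) e≤t²) ⟩
      e * ((t * t) * (4ℚ * (s * s)))       ≡⟨ cong (e *_) (solve 2 (λ t s → (t :* t) :* (con 4ℚ :* (s :* s)) := ((t :+ t) :* s) :* ((t :+ t) :* s)) refl t s) ⟩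
      e * (((t + t) * s) * ((t + t) * s))  ≡⟨ cong (e *_) [2ts]²≡1 ⟩
      e * 1ℚ                               ≡⟨ ℚ.*-identityʳ e ⟩
      e                                    ∎
      where open ℚ.≤-Reasoning
    k+2≤4[k+1] : ℕ→ℚ (suc (suc k)) ≤ 4ℚ * ℕ→ℚ (suc k)
    k+2≤4[k+1] = subst (ℕ→ℚ (suc (suc k)) ≤_) (ℕ→ℚ-* 4 (suc k)) (ℕ→ℚ-mono-≤ (ℕ.≤-trans (ℕ.+-mono-≤ {2} {4} (s≤s (s≤s z≤n)) (ℕ.m≤n*m k 4)) (ℕ.≤-reflexive (≡.sym (ℕ.*-suc 4 k)))))
    bound′ : ℕ→ℚ (suc (suc k)) * (t′ * t′ - r) ≤ excess₀
    bound′ = *-cancelˡ-≤ (ℕ→ℚ-pos {4} (s≤s z≤n)) (begin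
      4ℚ * (ℕ→ℚ (suc (suc k)) * (t′ * t′ - r))  ≡⟨ solve 3 (λ a b c → a :* (b :* c) := b :* (a :* c)) refl 4ℚ (ℕ→ℚ (suc (suc k))) (t′ * t′ - r) ⟩
      ℕ→ℚ (suc (suc k)) * (4ℚ * (t′ * t′ - r))  ≤⟨ *-monoˡ-≤ (ℕ→ℚ-nonNeg (suc (suc k))) quartered ⟩
      ℕ→ℚ (suc (suc k)) * e                     ≤⟨ *-monoʳ-≤ 0≤e k+2≤4[k+1] ⟩
      4ℚ * ℕ→ℚ (suc k) * e                      ≡⟨ ℚ.*-assoc 4ℚ (ℕ→ℚ (suc k)) e ⟩
      4ℚ * (ℕ→ℚ (suc k) * e)                    ≤⟨ *-monoˡ-≤ (ℕ→ℚ-nonNeg 4) bound ⟩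
      4ℚ * excess₀                              ∎)
      where open ℚ.≤-Reasoning

  iterate : ∀ k → Σ ℚ (Approximant k)
  iterate zero    = r + 1ℚ , ℚ.<-≤-trans 0<1 (subst (_≤ r + 1ℚ) (ℚ.+-identityˡ 1ℚ) (ℚ.+-monoˡ-≤ 1ℚ 0≤r))
                  , ≤-by-difference (r * r + r + 1ℚ) (+-nonNeg (+-nonNeg (square-nonNeg r) 0≤r) (ℚ.<⇒≤ 0<1))
                      (solve 1 (λ r → r :* r :+ r :+ con 1ℚ := (r :+ con 1ℚ) :* (r :+ con 1ℚ) :- r) refl r)
                  , ℚ.≤-reflexive (ℚ.*-identityˡ excess₀)
  iterate (suc k) = newton-step {k} (proj₂ (iterate k))

√-approx : ∀ {r δ} → 0ℚ ≤ r → 0ℚ < δ → Σ ℚ λ t → (0ℚ < t) × (r ≤ t * t) × (t * t ≤ r + δ)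
√-approx {r} {δ} 0≤r 0<δ with archimedean (excess₀ * recip δ 0<δ)
  where open Newton 0≤r
... | K , K≥ with Newton.iterate 0≤r K
...   | t , 0<t , r≤t² , bound = t , 0<t , r≤t² , t²≤r+δ
  where
  open Newton 0≤r using (excess₀)
  e = t * t - r
  excess₀≤δK : excess₀ ≤ δ * ℕ→ℚ K
  excess₀≤δK = begin
    excess₀                        ≡⟨ ℚ.*-identityʳ excess₀ ⟨
    excess₀ * 1ℚ                   ≡⟨ cong (excess₀ *_) (*-recip δ 0<δ) ⟨
    excess₀ * (δ * recip δ 0<δ)    ≡⟨ solve 3 (λ a b c → a :* (b :* c) := b :* (a :* c)) refl excess₀ δ (recip δ 0<δ) ⟩
    δ * (excess₀ * recip δ 0<δ)    ≤⟨ *-monoˡ-≤ (ℚ.<⇒≤ 0<δ) K≥ ⟩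
    δ * ℕ→ℚ K                      ∎
    where open ℚ.≤-Reasoning
  [K+1]e≤[K+1]δ : ℕ→ℚ (suc K) * e ≤ ℕ→ℚ (suc K) * δ
  [K+1]e≤[K+1]δ = ℚ.≤-trans bound (ℚ.≤-trans excess₀≤δK
    (ℚ.≤-trans (*-monoˡ-≤ (ℚ.<⇒≤ 0<δ) (ℕ→ℚ-mono-≤ (ℕ.n≤1+n K))) (ℚ.≤-reflexive (ℚ.*-comm δ _))))
  t²≤r+δ : t * t ≤ r + δ
  t²≤r+δ = ≤-by-difference (δ - e) (≤⇒0≤- (*-cancelˡ-≤ (ℕ→ℚ-pos {suc K} (s≤s z≤n)) [K+1]e≤[K+1]δ))
    (solve 3 (λ t r d → d :- (t :* t :- r) := r :+ d :- t :* t) refl t r δ)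

amgm-mean : (M S t : ℚ) → 0ℚ < t → ℚ
amgm-mean M S t 0<t = (S + t * t * M) * recip (t + t) (+-pos 0<t 0<t)

*≤amgm-mean² : ∀ M S t 0<t → M * S ≤ amgm-mean M S t 0<t * amgm-mean M S t 0<t
*≤amgm-mean² M S t 0<t = ≤-by-difference (((S - t * t * M) * s) * ((S - t * t * M) * s))
  (square-nonNeg ((S - t * t * M) * s)) (begin
    ((S - t * t * M) * s) * ((S - t * t * M) * s)                ≡⟨ solve 4 (λ M S t s →
        ((S :- t :* t :* M) :* s) :* ((S :- t :* t :* M) :* s)
          := ((S :+ t :* t :* M) :* s) :* ((S :+ t :* t :* M) :* s) :- M :* S :* (((t :+ t) :* s) :* ((t :+ t) :* s))) refl M S t s ⟩
    A * A - M * S * (((t + t) * s) * ((t + t) * s))             ≡⟨ cong (λ z → A * A - M * S * (z * z)) (*-recip (t + t) (+-pos 0<t 0<t)) ⟩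
    A * A - M * S * (1ℚ * 1ℚ)                                    ≡⟨ cong (λ z → A * A - z) (trans (cong (M * S *_) (ℚ.*-identityˡ 1ℚ)) (ℚ.*-identityʳ (M * S))) ⟩
    A * A - M * S                                                ∎)
  where
  open ≡-Reasoning
  s = recip (t + t) (+-pos 0<t 0<t)
  A = amgm-mean M S t 0<t

amgm-mean²-gap : ∀ M r g t 0<t → let s = recip (t + t) (+-pos 0<t 0<t) in
  (M * M * r + g) - amgm-mean M (M * r) t 0<t * amgm-mean M (M * r) t 0<t
    ≡ s * s * (4ℚ * r * g + (t * t - r) * (4ℚ * g - M * M * (t * t - r)))
amgm-mean²-gap M r g t 0<t = begin
  (M * M * r + g) - ((M * r + t * t * M) * s) * ((M * r + t * t * M) * s)  ≡⟨ solve 5 (λ M r g t s →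
      (M :* M :* r :+ g) :- ((M :* r :+ t :* t :* M) :* s) :* ((M :* r :+ t :* t :* M) :* s)
      := s :* s :* (con 4ℚ :* r :* g :+ (t :* t :- r) :* (con 4ℚ :* g :- M :* M :* (t :* t :- r)))
            :+ (M :* M :* r :+ g) :* (con 1ℚ :- ((t :+ t) :* s) :* ((t :+ t) :* s))) refl M r g t s ⟩
  s * s * D + (M * M * r + g) * (1ℚ - ((t + t) * s) * ((t + t) * s))    ≡⟨ cong (λ z → s * s * D + (M * M * r + g) * (1ℚ - z * z)) (*-recip (t + t) (+-pos 0<t 0<t)) ⟩
  s * s * D + (M * M * r + g) * (1ℚ - 1ℚ * 1ℚ)                          ≡⟨ solve 2 (λ a c → a :+ c :* (con 1ℚ :- con 1ℚ :* con 1ℚ) := a) refl (s * s * D) (M * M * r + g) ⟩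
  s * s * D                                                            ∎
  where
  open ≡-Reasoning
  s = recip (t + t) (+-pos 0<t 0<t)
  D = 4ℚ * r * g + (t * t - r) * (4ℚ * g - M * M * (t * t - r))

amgm-mean²-gap-pos : ∀ {M r g δ ε} → 0ℚ ≤ r → 0ℚ < g → 0ℚ < δ → M * M * δ ≡ g → δ ≤ ε → ε ≤ δ + δ →
  0ℚ < 4ℚ * r * g + ε * (4ℚ * g - M * M * ε)
amgm-mean²-gap-pos {M} {r} {g} {δ} {ε} 0≤r 0<g 0<δ MMδ≡g δ≤ε ε≤2δ =
  ℚ.≤-<-trans (*-nonNeg (*-nonNeg (ℕ→ℚ-nonNeg 4) 0≤r) (ℚ.<⇒≤ 0<g))
    (subst (_< 4ℚ * r * g + ε * (4ℚ * g - M * M * ε)) (ℚ.+-identityʳ (4ℚ * r * g))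
      (ℚ.+-monoʳ-< (4ℚ * r * g) (*-pos (ℚ.<-≤-trans 0<δ δ≤ε) 0<4g-MMε)))
  where
  0<4g-MMε : 0ℚ < 4ℚ * g - M * M * ε
  0<4g-MMε = ℚ.<-≤-trans (+-pos 0<g 0<g) (≤-by-difference (M * M * (δ + δ - ε)) (*-nonNeg (square-nonNeg M) (≤⇒0≤- ε≤2δ)) (begin
    M * M * (δ + δ - ε)                    ≡⟨ solve 3 (λ a d e → a :* (d :+ d :- e) := a :* d :+ a :* d :- a :* e) refl (M * M) δ ε ⟩
    M * M * δ + M * M * δ - M * M * ε      ≡⟨ cong (λ z → z + z - M * M * ε) MMδ≡g ⟩
    g + g - M * M * ε                      ≡⟨ solve 3 (λ g a e → g :+ g :- a :* e := con 4ℚ :* g :- a :* e :- (g :+ g)) refl g (M * M) ε ⟩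
    4ℚ * g - M * M * ε - (g + g)           ∎))
    where open ≡-Reasoning

≤*-if-≤-amgm-mean²-pos : ∀ {b M S} → 0ℚ < M → 0ℚ ≤ S →
  (∀ t 0<t → b ≤ amgm-mean M S t 0<t * amgm-mean M S t 0<t) → b ≤ M * S
≤*-if-≤-amgm-mean²-pos {b} {M} {S} 0<M 0≤S b≤A² with b ℚ.≤? M * S
... | yes b≤MS = b≤MS
... | no b≰MS = ⊥-elim (ℚ.<-irrefl refl (ℚ.≤-<-trans (b≤A² t 0<t) A²<b))
  where
  -- With g = b − M S > 0, any t with S/M + g/M² ≤ t² ≤ S/M + 2g/M² makes the mean too small.
  g = b - M * S
  0<g : 0ℚ < g
  0<g = <⇒0<- (ℚ.≰⇒> b≰MS)
  M⁻¹ = recip M 0<M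
  MM⁻¹≡1 : M * M⁻¹ ≡ 1ℚ
  MM⁻¹≡1 = *-recip M 0<M
  0<M⁻¹ : 0ℚ < M⁻¹
  0<M⁻¹ = recip-pos M 0<M
  r = S * M⁻¹
  0≤r : 0ℚ ≤ r
  0≤r = *-nonNeg 0≤S (ℚ.<⇒≤ 0<M⁻¹)
  δ = g * M⁻¹ * M⁻¹
  0<δ : 0ℚ < δ
  0<δ = *-pos (*-pos 0<g 0<M⁻¹) 0<M⁻¹
  approx = √-approx (+-nonNeg 0≤r (ℚ.<⇒≤ 0<δ)) 0<δ
  t = proj₁ approx
  0<t : 0ℚ < t
  0<t = proj₁ (proj₂ approx)
  S≡Mr : S ≡ M * r
  S≡Mr = trans (≡.sym (ℚ.*-identityʳ S)) (trans (cong (S *_) (≡.sym MM⁻¹≡1))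
    (solve 3 (λ S M i → S :* (M :* i) := M :* (S :* i)) refl S M M⁻¹))
  b≡MMr+g : b ≡ M * M * r + g
  b≡MMr+g = trans (solve 2 (λ b x → b := x :+ (b :- x)) refl b (M * S))
                  (cong (_+ g) (trans (cong (M *_) S≡Mr) (≡.sym (ℚ.*-assoc M M r))))
  MMδ≡g : M * M * δ ≡ g
  MMδ≡g = trans (solve 3 (λ M g i → M :* M :* (g :* i :* i) := g :* (M :* i) :* (M :* i)) refl M g M⁻¹)
                (trans (cong₂ (λ a c → g * a * c) MM⁻¹≡1 MM⁻¹≡1) (trans (ℚ.*-identityʳ (g * 1ℚ)) (ℚ.*-identityʳ g)))
  δ≤ε : δ ≤ t * t - r
  δ≤ε = ≤-by-difference (t * t - (r + δ)) (≤⇒0≤- (proj₁ (proj₂ (proj₂ approx))))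
    (solve 3 (λ t r d → t :* t :- (r :+ d) := t :* t :- r :- d) refl t r δ)
  ε≤2δ : t * t - r ≤ δ + δ
  ε≤2δ = ≤-by-difference (r + δ + δ - t * t) (≤⇒0≤- (proj₂ (proj₂ (proj₂ approx))))
    (solve 3 (λ t r d → r :+ d :+ d :- t :* t := d :+ d :- (t :* t :- r)) refl t r δ)
  s = recip (t + t) (+-pos 0<t 0<t)
  0<s : 0ℚ < s
  0<s = recip-pos (t + t) (+-pos 0<t 0<t)
  A²<b : amgm-mean M S t 0<t * amgm-mean M S t 0<t < b
  A²<b = <-by-difference (s * s * (4ℚ * r * g + (t * t - r) * (4ℚ * g - M * M * (t * t - r))))
    (*-pos (*-pos 0<s 0<s) (amgm-mean²-gap-pos {M} 0≤r 0<g 0<δ MMδ≡g δ≤ε ε≤2δ))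
    (≡.sym (trans (cong₂ (λ x y → x - amgm-mean M y t 0<t * amgm-mean M y t 0<t) b≡MMr+g S≡Mr) (amgm-mean²-gap M r g t 0<t)))

≤*-if-≤-amgm-mean² : ∀ {b M S} → 0ℚ ≤ M → 0ℚ ≤ S → (M ≡ 0ℚ → S ≡ 0ℚ) →
  (∀ t 0<t → b ≤ amgm-mean M S t 0<t * amgm-mean M S t 0<t) → b ≤ M * S
≤*-if-≤-amgm-mean² {b} {M} {S} 0≤M 0≤S M≡0⇒S≡0 b≤A² with 0ℚ ℚ.<? M
... | yes 0<M = ≤*-if-≤-amgm-mean²-pos 0<M 0≤S b≤A²
... | no 0≮M = subst (b ≤_) A²≡MS (b≤A² 1ℚ 0<1)
  where
  M≡0 : M ≡ 0ℚ
  M≡0 = ℚ.≤-antisym (ℚ.≮⇒≥ 0≮M) 0≤M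
  A≡0 : amgm-mean M S 1ℚ 0<1 ≡ 0ℚ
  A≡0 = cong₂ (λ x y → (x + 1ℚ * 1ℚ * y) * recip (1ℚ + 1ℚ) (+-pos 0<1 0<1)) (M≡0⇒S≡0 M≡0) M≡0
  A²≡MS : amgm-mean M S 1ℚ 0<1 * amgm-mean M S 1ℚ 0<1 ≡ M * S
  A²≡MS = trans (cong (λ z → z * z) A≡0) (≡.sym (trans (cong (_* S) M≡0) (ℚ.*-zeroˡ S)))

-- Relabelling vertices

sumℕ-remove : ∀ {k} (f : Fin (suc k) → ℕ) j → sumℕ f ≡ f j ℕ.+ sumℕ (λ i → f (punchIn j i))
sumℕ-remove f j rewrite sumℕ≡sum f | sumℕ≡sum (λ i → f (punchIn j i)) = ℕΣ.sum-remove f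

sumℕ-bijection : ∀ {k} (π : Fin k ⤖ Fin k) (f : Fin k → ℕ) → sumℕ (λ u → f (Bijection.to π u)) ≡ sumℕ f
sumℕ-bijection π f rewrite sumℕ≡sum (λ u → f (Bijection.to π u)) | sumℕ≡sum f = ≡.sym (ℕΣ.sum-permute f (⤖⇒↔ π))

count-not : ∀ {k} {γ δ : Fin k → Bool} → count γ ≡ count δ → count (λ i → not (γ i)) ≡ count (λ i → not (δ i))
count-not {k} {γ} {δ} eq = ℕ.+-cancelˡ-≡ (count γ) _ _
  (trans (count-+-count-not γ) (≡.sym (trans (cong (ℕ._+ count (λ i → not (δ i))) eq) (count-+-count-not δ))))

relabel : ∀ {k} (γ δ : Fin k → Bool) → count γ ≡ count δ →
  Σ (Fin k ⤖ Fin k) λ π → ∀ u → δ (Bijection.to π u) ≡ γ u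
relabel {zero}  γ δ _ = mk⤖ ((λ eq → eq) , (λ y → y , (λ eq → eq))) , (λ ())
relabel {suc k} γ δ eq = mk⤖ (injective , strictlySurjective⇒surjective surjective) , preserves
  where
  match : ∀ b → γ zero ≡ b → Σ (Fin (suc k)) (λ j → δ j ≡ b)
  match true  γ₀ = exists-if-count-pos δ (subst (1 ℕ.≤_) eq (subst (λ b → 1 ℕ.≤ 𝟙 b ℕ.+ count (λ i → γ (suc i))) (≡.sym γ₀) (s≤s z≤n)))
  match false γ₀ with exists-if-count-pos (λ i → not (δ i))
                         (subst (1 ℕ.≤_) (count-not {γ = γ} {δ} eq)
                           (subst (λ b → 1 ℕ.≤ 𝟙 (not b) ℕ.+ count (λ i → not (γ (suc i)))) (≡.sym γ₀) (s≤s z≤n)))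
  ... | j , not-δj = j , trans (≡.sym (not-involutive (δ j))) (cong not not-δj)
  j : Fin (suc k)
  j = proj₁ (match (γ zero) refl)
  δj≡γ₀ : δ j ≡ γ zero
  δj≡γ₀ = proj₂ (match (γ zero) refl)
  rest = relabel (λ i → γ (suc i)) (λ i → δ (punchIn j i))
    (ℕ.+-cancelˡ-≡ (𝟙 (γ zero)) _ _ (trans eq (trans (sumℕ-remove (λ i → 𝟙 (δ i)) j) (cong (λ b → 𝟙 b ℕ.+ count (λ i → δ (punchIn j i))) δj≡γ₀))))
  π′ = Bijection.to (proj₁ rest)
  π : Fin (suc k) → Fin (suc k)
  π zero    = j
  π (suc u) = punchIn j (π′ u)
  preserves : ∀ u → δ (π u) ≡ γ u
  preserves zero    = δj≡γ₀
  preserves (suc u) = proj₂ rest u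
  injective : ∀ {x y} → π x ≡ π y → x ≡ y
  injective {zero}  {zero}  _  = refl
  injective {zero}  {suc y} eq = ⊥-elim (punchInᵢ≢i j (π′ y) (≡.sym eq))
  injective {suc x} {zero}  eq = ⊥-elim (punchInᵢ≢i j (π′ x) eq)
  injective {suc x} {suc y} eq = cong suc (Bijection.injective (proj₁ rest) (punchIn-injective j (π′ x) (π′ y) eq))
  surjective : ∀ y → Σ (Fin (suc k)) (λ x → π x ≡ y)
  surjective y with y ≟ j
  ... | yes refl = zero , refl
  ... | no y≢j with Bijection.surjective (proj₁ rest) (punchOut (λ j≡y → y≢j (≡.sym j≡y)))
  ...   | x , πx≡ = suc x , trans (cong (punchIn j) (πx≡ refl)) (punchIn-punchOut _)

count-<ᵇ : ∀ k h → h ℕ.≤ k → count {k} (λ i → toℕ i <ᵇ h) ≡ h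
count-<ᵇ zero    .zero z≤n       = refl
count-<ᵇ (suc k) zero  _         = trans (sumℕ-const (suc k) 0) (ℕ.*-zeroʳ (suc k))
count-<ᵇ (suc k) (suc h) (s≤s h≤k) = cong suc (count-<ᵇ k h h≤k)

≅T₂ : ∀ {n} (G : Graph n) (γ : Fin n → Bool) → (∀ u v → adj G u v ≡ (γ u xor γ v)) →
  count γ ≡ n ℕ./ 2 → G ≅ T₂ n
≅T₂ {n} G γ adj≡xor count≡ = π , λ u v → trans (adj≡xor u v) (cong₂ _xor_ (≡.sym (relabels u)) (≡.sym (relabels v)))
  where
  halves = relabel γ (λ i → toℕ i <ᵇ (n ℕ./ 2)) (trans count≡ (≡.sym (count-<ᵇ n (n ℕ./ 2) (ℕ.m/n≤m n 2))))
  π = proj₁ halves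
  relabels = proj₂ halves

-- Graphs

restrict : ∀ {n} → (Fin n → Fin n → Bool) → (Fin n → Fin n → ℚ) → Fin n → Fin n → ℚ
restrict R f u v = if R u v then f u v else 0ℚ

sumOver : ∀ {n} → (Fin n → Fin n → Bool) → (Fin n → Fin n → ℚ) → ℚ
sumOver R f = sumℚ (λ u → sumℚ (restrict R f u))

pairCount : ∀ {n} → (Fin n → Fin n → Bool) → ℕ
pairCount R = sumℕ (λ u → count (R u))

module _ {n : ℕ} (R : Fin n → Fin n → Bool) where

  sumOver-+ : ∀ f g → sumOver R (λ u v → f u v + g u v) ≡ sumOver R f + sumOver R g
  sumOver-+ f g = trans (sumℚ-cong (λ u → trans (sumℚ-cong (λ v → if-+ (R u v))) (sumℚ-+ (restrict R f u) (restrict R g u))))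
                        (sumℚ-+ (λ u → sumℚ (restrict R f u)) (λ u → sumℚ (restrict R g u)))
    where
    if-+ : ∀ b {x y} → (if b then x + y else 0ℚ) ≡ (if b then x else 0ℚ) + (if b then y else 0ℚ)
    if-+ true  = refl
    if-+ false = refl

  sumOver-*ʳ : ∀ f c → sumOver R (λ u v → f u v * c) ≡ sumOver R f * c
  sumOver-*ʳ f c = trans (sumℚ-cong (λ u → trans (sumℚ-cong (λ v → if-*ʳ (R u v))) (sumℚ-*ʳ (restrict R f u) c)))
                         (sumℚ-*ʳ (λ u → sumℚ (restrict R f u)) c)
    where
    if-*ʳ : ∀ b {x} → (if b then x * c else 0ℚ) ≡ (if b then x else 0ℚ) * c
    if-*ʳ true  = refl
    if-*ʳ false = ≡.sym (ℚ.*-zeroˡ c)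

  sumOver-const : ∀ c → sumOver R (λ _ _ → c) ≡ c * ℕ→ℚ (pairCount R)
  sumOver-const c = begin
    sumOver R (λ _ _ → c)                 ≡⟨ sumℚ-cong (λ u → sumℚ-if (R u) c) ⟩
    sumℚ (λ u → c * ℕ→ℚ (count (R u)))    ≡⟨ sumℚ-*ˡ c (λ u → ℕ→ℚ (count (R u))) ⟩
    c * sumℚ (λ u → ℕ→ℚ (count (R u)))    ≡⟨ cong (c *_) (sumℚ-ℕ→ℚ (λ u → count (R u))) ⟩
    c * ℕ→ℚ (pairCount R)                 ∎
    where open ≡-Reasoning

  sumOver-mono-≤ : ∀ {f g} → (∀ u v → R u v ≡ true → f u v ≤ g u v) → sumOver R f ≤ sumOver R g
  sumOver-mono-≤ f≤g = sumℚ-mono-≤ (λ u → sumℚ-mono-≤ (λ v → if-mono (R u v) (f≤g u v)))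
    where
    if-mono : ∀ b {x y} → (b ≡ true → x ≤ y) → (if b then x else 0ℚ) ≤ (if b then y else 0ℚ)
    if-mono true  x≤y = x≤y refl
    if-mono false _   = ℚ.≤-refl

  restrict-nonNeg : ∀ {f} → (∀ u v → R u v ≡ true → 0ℚ ≤ f u v) → ∀ u v → 0ℚ ≤ restrict R f u v
  restrict-nonNeg 0≤f u v with R u v in Ruv
  ... | true  = 0≤f u v Ruv
  ... | false = ℚ.≤-refl

  sumOver-nonNeg : ∀ {f} → (∀ u v → R u v ≡ true → 0ℚ ≤ f u v) → 0ℚ ≤ sumOver R f
  sumOver-nonNeg 0≤f = sumℚ-nonNeg (λ u → sumℚ-nonNeg (restrict-nonNeg 0≤f u))

  private
    one = restrict R (λ _ _ → 1ℚ)

    0≤one : ∀ u v → 0ℚ ≤ one u v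
    0≤one = restrict-nonNeg (λ _ _ _ → ℕ→ℚ-nonNeg 1)

    Σone≡pairCount : sumℚ (λ u → sumℚ (one u)) ≡ ℕ→ℚ (pairCount R)
    Σone≡pairCount = trans (sumOver-const 1ℚ) (ℚ.*-identityˡ (ℕ→ℚ (pairCount R)))

  sumOver-Cauchy–Schwarz : ∀ f → sumOver R f * sumOver R f ≤ ℕ→ℚ (pairCount R) * sumOver R (λ u v → f u v * f u v)
  sumOver-Cauchy–Schwarz f = subst (λ z → sumOver R f * sumOver R f ≤ z * sumOver R f²) Σone≡pairCount
    (sumℚ-Cauchy–Schwarz (λ u → sumℚ (one u)) (λ u → sumℚ (restrict R f u)) (λ u → sumℚ (restrict R f² u))
      (λ u → sumℚ-nonNeg (0≤one u)) (λ u → sumℚ-nonNeg (0≤f² u))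
      (λ u → sumℚ-Cauchy–Schwarz (one u) (restrict R f u) (restrict R f² u) (0≤one u) (0≤f² u) (λ v → pointwise (R u v))))
    where
    f² = λ u v → f u v * f u v
    0≤f² : ∀ u v → 0ℚ ≤ restrict R f² u v
    0≤f² = restrict-nonNeg (λ u v _ → square-nonNeg (f u v))
    pointwise : ∀ b {x} → (if b then x else 0ℚ) * (if b then x else 0ℚ) ≤ (if b then 1ℚ else 0ℚ) * (if b then x * x else 0ℚ)
    pointwise true  = ℚ.≤-reflexive (≡.sym (ℚ.*-identityˡ _))
    pointwise false = ℚ.≤-refl

  -- Every term p with c ≤ p² d (p ≥ 0) contributes at least √(c/d) to the sum.
  sumOver-√-scaled : ∀ {c d} (p : Fin n → Fin n → ℚ) → 0ℚ ≤ c → 0ℚ ≤ d →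
    (∀ u v → R u v ≡ true → 0ℚ ≤ p u v × c ≤ p u v * p u v * d) →
    ℕ→ℚ (pairCount R) * ℕ→ℚ (pairCount R) * c ≤ sumOver R p * sumOver R p * d
  sumOver-√-scaled {c} {d} p 0≤c 0≤d h = subst (λ z → z * z * c ≤ sumOver R p * sumOver R p * d) Σone≡pairCount
    (sumℚ-√-scaled (λ u → sumℚ (one u)) (λ u → sumℚ (restrict R p u)) 0≤c 0≤d
      (λ u → sumℚ-nonNeg (0≤one u)) (λ u → sumℚ-nonNeg (0≤p u))
      (λ u → sumℚ-√-scaled (one u) (restrict R p u) 0≤c 0≤d (0≤one u) (0≤p u) (pointwise u)))
    where
    0≤p : ∀ u v → 0ℚ ≤ restrict R p u v
    0≤p = restrict-nonNeg (λ u v Ruv → proj₁ (h u v Ruv))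
    0*0*x≡0 : ∀ x → 0ℚ * 0ℚ * x ≡ 0ℚ
    0*0*x≡0 x = trans (cong (_* x) (ℚ.*-zeroˡ 0ℚ)) (ℚ.*-zeroˡ x)
    pointwise : ∀ u v → one u v * one u v * c ≤ restrict R p u v * restrict R p u v * d
    pointwise u v with R u v in Ruv
    ... | true  = subst (_≤ p u v * p u v * d) (≡.sym (trans (cong (_* c) (ℚ.*-identityˡ 1ℚ)) (ℚ.*-identityˡ c)))
                    (proj₂ (h u v Ruv))
    ... | false = ℚ.≤-reflexive (trans (0*0*x≡0 c) (≡.sym (0*0*x≡0 d)))

another : ∀ {n} → 2 ℕ.≤ n → (u : Fin n) → Σ (Fin n) (u ≢_)
another {suc (suc _)} _ u = punchIn u zero , λ u≡ → punchInᵢ≢i u zero (≡.sym u≡)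
another {suc zero} (s≤s ()) _

module _ {n : ℕ} (G : Graph n) where

  isEdge : Fin n → Fin n → Bool
  isEdge u v = adj G u v ∧ ⌊ u <? v ⌋

  edgeCount : ℕ
  edgeCount = pairCount isEdge

  isEdge⇒Adj : ∀ {u v} → isEdge u v ≡ true → Adj G u v
  isEdge⇒Adj {u} {v} eq with adj G u v
  ... | true = refl

  Adj-sym : ∀ {u v} → Adj G u v → Adj G v u
  Adj-sym {u} {v} uv = trans (Graph.sym G v u) uv

  deg-pos : ∀ {u v} → Adj G u v → 1 ℕ.≤ deg G u
  deg-pos {u} {v} uv = subst (λ b → 𝟙 b ℕ.≤ deg G u) uv (≤-sumℕ (λ w → 𝟙 (adj G u w)) v)

  -- Each edge is counted once as (u, v) with u < v and once as (v, u).
  sumOver-adj≡edgeSum+edgeSum : ∀ f → (∀ u v → f u v ≡ f v u) → sumOver (adj G) f ≡ edgeSum G f + edgeSum G f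
  sumOver-adj≡edgeSum+edgeSum f f-sym = begin
    sumOver (adj G) f                                      ≡⟨ sumℚ-cong (λ u → trans (sumℚ-cong (split u)) (sumℚ-+ (restrict isEdge f u) (flipped u))) ⟩
    sumℚ (λ u → sumℚ (restrict isEdge f u) + sumℚ (flipped u))  ≡⟨ sumℚ-+ (λ u → sumℚ (restrict isEdge f u)) (λ u → sumℚ (flipped u)) ⟩
    edgeSum G f + sumℚ (λ u → sumℚ (flipped u))           ≡⟨ cong (_+_ (edgeSum G f)) (sumℚ-comm (λ u v → restrict isEdge f v u)) ⟩
    edgeSum G f + edgeSum G f                              ∎
    where
    open ≡-Reasoning
    flipped : Fin n → Fin n → ℚ
    flipped u v = restrict isEdge f v u
    split : ∀ u v → restrict (adj G) f u v ≡ restrict isEdge f u v + flipped u v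
    split u v with adj G u v in uv | adj G v u in vu
    ... | false | false = ≡.sym (ℚ.+-identityˡ 0ℚ)
    ... | false | true  = ⊥-elim (false≢true (trans (≡.sym uv) (trans (Graph.sym G u v) vu)))
      where false≢true : false ≢ true
            false≢true ()
    ... | true  | false = ⊥-elim (false≢true (trans (≡.sym vu) (trans (Graph.sym G v u) uv)))
      where false≢true : false ≢ true
            false≢true ()
    ... | true  | true with u <? v | v <? u
    ...   | yes u<v | yes v<u = ⊥-elim (<-asym u<v v<u)
    ...   | yes _   | no _    = ≡.sym (ℚ.+-identityʳ (f u v))
    ...   | no _    | yes _   = trans (f-sym u v) (≡.sym (ℚ.+-identityˡ (f v u)))
    ...   | no u≮v  | no v≮u with <-cmp u v
    ...     | tri< u<v _ _ = ⊥-elim (u≮v u<v)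
    ...     | tri> _ _ v<u = ⊥-elim (v≮u v<u)
    ...     | tri≈ _ refl _ = ⊥-elim (true≢false (trans (≡.sym uv) (Graph.irrefl G u)))
      where true≢false : true ≢ false
            true≢false ()

  handshake : sumℕ (deg G) ≡ edgeCount ℕ.+ edgeCount
  handshake = ℕ→ℚ-injective (begin
    ℕ→ℚ (sumℕ (deg G))                  ≡⟨ ℚ.*-identityˡ (ℕ→ℚ (sumℕ (deg G))) ⟨
    1ℚ * ℕ→ℚ (pairCount (adj G))        ≡⟨ sumOver-const (adj G) 1ℚ ⟨
    sumOver (adj G) (λ _ _ → 1ℚ)        ≡⟨ sumOver-adj≡edgeSum+edgeSum (λ _ _ → 1ℚ) (λ _ _ → refl) ⟩
    edgeSum G (λ _ _ → 1ℚ) + edgeSum G (λ _ _ → 1ℚ)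
                                        ≡⟨ cong (λ z → z + z) (trans (sumOver-const isEdge 1ℚ) (ℚ.*-identityˡ (ℕ→ℚ edgeCount))) ⟩
    ℕ→ℚ edgeCount + ℕ→ℚ edgeCount       ≡⟨ ℕ→ℚ-+ edgeCount edgeCount ⟨
    ℕ→ℚ (edgeCount ℕ.+ edgeCount)       ∎)
    where open ≡-Reasoning

  connected⇒deg-pos : Connected G → 2 ℕ.≤ n → ∀ u → 1 ℕ.≤ deg G u
  connected⇒deg-pos connected 2≤n u with another 2≤n u
  ... | v , u≢v with connected u v
  ...   | here          = ⊥-elim (u≢v refl)
  ...   | step uw _     = deg-pos uw

  connected⇒n≤2*edgeCount : Connected G → 2 ℕ.≤ n → n ℕ.≤ edgeCount ℕ.+ edgeCount
  connected⇒n≤2*edgeCount connected 2≤n = subst₂ ℕ._≤_ (trans (sumℕ-const n 1) (ℕ.*-identityʳ n)) handshake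
    (sumℕ-mono-≤ (connected⇒deg-pos connected 2≤n))

module _ {n : ℕ} (G : Graph n) where

  private
    d = deg G

  abc² : Fin n → Fin n → ℚ
  abc² u v = edgeNum G u v * inv (d u ℕ.* d v)

  abc²-sym : ∀ u v → abc² u v ≡ abc² v u
  abc²-sym u v = cong₂ _*_ (cong (λ z → ℕ→ℚ (z ∸ 2)) (ℕ.+-comm (d u) (d v))) (cong inv (ℕ.*-comm (d u) (d v)))

  abc²-nonNeg : ∀ u v → 0ℚ ≤ abc² u v
  abc²-nonNeg u v = *-nonNeg (ℕ→ℚ-nonNeg (d u ℕ.+ d v ∸ 2)) (inv-nonNeg (d u ℕ.* d v))

  1≤d*d : ∀ {u v} → Adj G u v → 1 ℕ.≤ d u ℕ.* d v
  1≤d*d uv = ℕ.*-mono-≤ (deg-pos G uv) (deg-pos G (Adj-sym G uv))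

  abc²+2/dd≡1/d+1/d : ∀ {u v} → Adj G u v → abc² u v + ℕ→ℚ 2 * inv (d u ℕ.* d v) ≡ inv (d u) + inv (d v)
  abc²+2/dd≡1/d+1/d {u} {v} uv = begin
    abc² u v + ℕ→ℚ 2 * inv (d u ℕ.* d v)             ≡⟨ ℚ.*-distribʳ-+ (inv (d u ℕ.* d v)) (ℕ→ℚ (d u ℕ.+ d v ∸ 2)) (ℕ→ℚ 2) ⟨
    (ℕ→ℚ (d u ℕ.+ d v ∸ 2) + ℕ→ℚ 2) * inv (d u ℕ.* d v)
      ≡⟨ cong₂ _*_ (trans (≡.sym (ℕ→ℚ-+ (d u ℕ.+ d v ∸ 2) 2)) (cong ℕ→ℚ (ℕ.m∸n+n≡m 2≤du+dv))) (inv-* 1≤du 1≤dv) ⟩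
    ℕ→ℚ (d u ℕ.+ d v) * (inv (d u) * inv (d v))       ≡⟨ cong (_* (inv (d u) * inv (d v))) (ℕ→ℚ-+ (d u) (d v)) ⟩
    (x + y) * (x⁻¹ * y⁻¹)                             ≡⟨ solve 4 (λ x y x⁻¹ y⁻¹ → (x :+ y) :* (x⁻¹ :* y⁻¹) := (x :* x⁻¹) :* y⁻¹ :+ (y :* y⁻¹) :* x⁻¹) refl x y x⁻¹ y⁻¹ ⟩
    (x * x⁻¹) * y⁻¹ + (y * y⁻¹) * x⁻¹                 ≡⟨ cong₂ _+_ (cong (_* y⁻¹) (ℕ→ℚ*inv 1≤du)) (cong (_* x⁻¹) (ℕ→ℚ*inv 1≤dv)) ⟩
    1ℚ * y⁻¹ + 1ℚ * x⁻¹                               ≡⟨ trans (cong₂ _+_ (ℚ.*-identityˡ y⁻¹) (ℚ.*-identityˡ x⁻¹)) (ℚ.+-comm y⁻¹ x⁻¹) ⟩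
    x⁻¹ + y⁻¹                                         ∎
    where
    open ≡-Reasoning
    1≤du : 1 ℕ.≤ d u
    1≤du = deg-pos G uv
    1≤dv : 1 ℕ.≤ d v
    1≤dv = deg-pos G (Adj-sym G uv)
    2≤du+dv : 2 ℕ.≤ d u ℕ.+ d v
    2≤du+dv = ℕ.+-mono-≤ 1≤du 1≤dv
    x = ℕ→ℚ (d u)
    y = ℕ→ℚ (d v)
    x⁻¹ = inv (d u)
    y⁻¹ = inv (d v)

  LowerApprox⇒≤abc² : ∀ {q u v} → Adj G u v → LowerApprox q (edgeNum G u v) (edgeDen G u v) → q * q ≤ abc² u v
  LowerApprox⇒≤abc² {q} {u} {v} uv (_ , q²den≤num) = ≤-*inv (d u ℕ.* d v) (1≤d*d uv) q²den≤num

  abc²-UpperApprox : ∀ {p u v} → Adj G u v → 0ℚ ≤ p → abc² u v ≤ p * p → UpperApprox p (edgeNum G u v) (edgeDen G u v)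
  abc²-UpperApprox {p} {u} {v} uv 0≤p abc²≤p² = 0≤p , (begin
    edgeNum G u v                                ≡⟨ ℚ.*-identityʳ (edgeNum G u v) ⟨
    edgeNum G u v * 1ℚ                           ≡⟨ cong (edgeNum G u v *_) (trans (ℚ.*-comm (inv k) (ℕ→ℚ k)) (ℕ→ℚ*inv (1≤d*d uv))) ⟨
    edgeNum G u v * (inv k * ℕ→ℚ k)              ≡⟨ ℚ.*-assoc (edgeNum G u v) (inv k) (ℕ→ℚ k) ⟨
    abc² u v * ℕ→ℚ k                             ≤⟨ *-monoʳ-≤ (ℕ→ℚ-nonNeg k) abc²≤p² ⟩
    p * p * ℕ→ℚ k                                ∎)
    where
    open ℚ.≤-Reasoning
    k = d u ℕ.* d v

  edgeSum²≤edgeCount*Σabc² : ∀ (q : Fin n → Fin n → ℚ) →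
    (∀ u v → Adj G u v → LowerApprox (q u v) (edgeNum G u v) (edgeDen G u v)) →
    edgeSum G q * edgeSum G q ≤ ℕ→ℚ (edgeCount G) * edgeSum G abc²
  edgeSum²≤edgeCount*Σabc² q lower = ℚ.≤-trans (sumOver-Cauchy–Schwarz (isEdge G) q)
    (*-monoˡ-≤ (ℕ→ℚ-nonNeg (edgeCount G))
      (sumOver-mono-≤ (isEdge G) (λ u v e → LowerApprox⇒≤abc² (isEdge⇒Adj G e) (lower u v (isEdge⇒Adj G e)))))

  -- The uniform choice p = (abc² + t²)/2t of upper approximants gives ABC(G)² ≤ m Σ abc² in the limit.
  ABC≥√⇒≤edgeCount*Σabc² : ∀ {b} → ABC≥√ G b → b ≤ ℕ→ℚ (edgeCount G) * edgeSum G abc²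
  ABC≥√⇒≤edgeCount*Σabc² {b} ABC≥√b = ≤*-if-≤-amgm-mean² (ℕ→ℚ-nonNeg m) (sumOver-nonNeg (isEdge G) (λ u v _ → abc²-nonNeg u v))
    m≡0⇒Σ≡0 (λ t 0<t → subst (λ z → b ≤ z * z) (edgeSum-mean t 0<t) (ABC≥√b (p t 0<t) (λ u v uv → p-valid t 0<t uv)))
    where
    m = edgeCount G
    p : ∀ t → 0ℚ < t → Fin n → Fin n → ℚ
    p t 0<t u v = amgm-mean 1ℚ (abc² u v) t 0<t
    p-valid : ∀ t 0<t {u v} → Adj G u v → UpperApprox (p t 0<t u v) (edgeNum G u v) (edgeDen G u v)
    p-valid t 0<t {u} {v} uv = abc²-UpperApprox uv
      (*-nonNeg (+-nonNeg (abc²-nonNeg u v) (*-nonNeg (square-nonNeg t) (ℕ→ℚ-nonNeg 1))) (ℚ.<⇒≤ (recip-pos (t + t) (+-pos 0<t 0<t))))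
      (subst (_≤ p t 0<t u v * p t 0<t u v) (ℚ.*-identityˡ (abc² u v)) (*≤amgm-mean² 1ℚ (abc² u v) t 0<t))
    edgeSum-mean : ∀ t 0<t → edgeSum G (p t 0<t) ≡ amgm-mean (ℕ→ℚ m) (edgeSum G abc²) t 0<t
    edgeSum-mean t 0<t = begin
      edgeSum G (p t 0<t)                                             ≡⟨ sumOver-*ʳ (isEdge G) (λ u v → abc² u v + t * t * 1ℚ) s ⟩
      edgeSum G (λ u v → abc² u v + t * t * 1ℚ) * s                  ≡⟨ cong (_* s) (sumOver-+ (isEdge G) abc² (λ _ _ → t * t * 1ℚ)) ⟩
      (edgeSum G abc² + edgeSum G (λ _ _ → t * t * 1ℚ)) * s           ≡⟨ cong (λ z → (edgeSum G abc² + z) * s) (sumOver-const (isEdge G) (t * t * 1ℚ)) ⟩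
      (edgeSum G abc² + t * t * 1ℚ * ℕ→ℚ m) * s                      ≡⟨ cong (λ z → (edgeSum G abc² + z) * s) (cong (_* ℕ→ℚ m) (ℚ.*-identityʳ (t * t))) ⟩
      amgm-mean (ℕ→ℚ m) (edgeSum G abc²) t 0<t                       ∎
      where
      open ≡-Reasoning
      s = recip (t + t) (+-pos 0<t 0<t)
    m≡0⇒Σ≡0 : ℕ→ℚ m ≡ 0ℚ → edgeSum G abc² ≡ 0ℚ
    m≡0⇒Σ≡0 m≡0 = ℚ.≤-antisym (x*x≤y*y⇒x≤y (sumOver-nonNeg (isEdge G) (λ u v _ → abc²-nonNeg u v)) ℚ.≤-refl
      (subst (edgeSum G abc² * edgeSum G abc² ≤_) (trans (cong (_* Σabc²²) m≡0) (trans (ℚ.*-zeroˡ Σabc²²) (≡.sym (ℚ.*-zeroˡ 0ℚ))))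
        (sumOver-Cauchy–Schwarz (isEdge G) abc²)))
      (sumOver-nonNeg (isEdge G) (λ u v _ → abc²-nonNeg u v))
      where Σabc²² = edgeSum G (λ u v → abc² u v * abc² u v)

P*[m*S]+2*m*m≤m*n*P : ∀ {m P S} n → 1 ℕ.≤ P → S + ℕ→ℚ 2 * inv P * ℕ→ℚ m ≤ ℕ→ℚ n →
  ℕ→ℚ P * (ℕ→ℚ m * S) + ℕ→ℚ 2 * ℕ→ℚ m * ℕ→ℚ m ≤ ℕ→ℚ (m ℕ.* n ℕ.* P)
P*[m*S]+2*m*m≤m*n*P {m} {P} {S} n 1≤P bound = begin
  p * (x * S) + two * x * x                 ≡⟨ cong (_+_ (p * (x * S))) (trans (≡.sym (ℚ.*-identityʳ (two * x * x))) (cong (two * x * x *_) (≡.sym (ℕ→ℚ*inv 1≤P)))) ⟩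
  p * (x * S) + two * x * x * (p * inv P)  ≡⟨ solve 5 (λ p x S t i → p :* (x :* S) :+ t :* x :* x :* (p :* i) := (x :* p) :* (S :+ t :* i :* x)) refl p x S two (inv P) ⟩
  (x * p) * (S + two * inv P * x)           ≤⟨ *-monoˡ-≤ (*-nonNeg (ℕ→ℚ-nonNeg m) (ℕ→ℚ-nonNeg P)) bound ⟩
  (x * p) * ℕ→ℚ n                           ≡⟨ solve 3 (λ a b c → (a :* b) :* c := a :* c :* b) refl x p (ℕ→ℚ n) ⟩
  x * ℕ→ℚ n * p                             ≡⟨ trans (ℕ→ℚ-* (m ℕ.* n) P) (cong (_* p) (ℕ→ℚ-* m n)) ⟨
  ℕ→ℚ (m ℕ.* n ℕ.* P)                       ∎
  where
  open ℚ.≤-Reasoning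
  p = ℕ→ℚ P
  x = ℕ→ℚ m
  two = ℕ→ℚ 2

ℕ→ℚ-P*P*k+2*m*m : ∀ m P k → ℕ→ℚ (P ℕ.* P ℕ.* k ℕ.+ 2 ℕ.* m ℕ.* m) ≡ ℕ→ℚ P * ℕ→ℚ (P ℕ.* k) + ℕ→ℚ 2 * ℕ→ℚ m * ℕ→ℚ m
ℕ→ℚ-P*P*k+2*m*m m P k = trans (ℕ→ℚ-+ (P ℕ.* P ℕ.* k) (2 ℕ.* m ℕ.* m))
  (cong₂ _+_ (trans (cong ℕ→ℚ (ℕ.*-assoc P P k)) (ℕ→ℚ-* P (P ℕ.* k)))
             (trans (ℕ→ℚ-* (2 ℕ.* m) m) (cong (_* ℕ→ℚ m) (ℕ→ℚ-* 2 m))))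

-- S + 2m/P ≤ n makes m S ≤ m (n − 2m/P), and the latter is at most P (n − 2) for m ≤ P ≤ n²/4.
m*S≤P*[n∸2] : ∀ {m P S} n → m ℕ.≤ P → 4 ℕ.* P ℕ.≤ n ℕ.* n → (1 ℕ.≤ P → 2 ℕ.≤ n) →
  S + ℕ→ℚ 2 * inv P * ℕ→ℚ m ≤ ℕ→ℚ n → ℕ→ℚ m * S ≤ ℕ→ℚ (P ℕ.* (n ∸ 2))
m*S≤P*[n∸2] {zero} {P} {S} n _ _ _ _ = subst (_≤ ℕ→ℚ (P ℕ.* (n ∸ 2))) (≡.sym (ℚ.*-zeroˡ S)) (ℕ→ℚ-nonNeg (P ℕ.* (n ∸ 2)))
m*S≤P*[n∸2] {m@(suc _)} {P} {S} n m≤P 4P≤n² 2≤n bound = *-cancelˡ-≤ (ℕ→ℚ-pos 1≤P)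
  (+-cancelʳ-≤ (ℚ.≤-trans (P*[m*S]+2*m*m≤m*n*P {m} {P} {S} n 1≤P bound) (subst (ℕ→ℚ (m ℕ.* n ℕ.* P) ≤_) (ℕ→ℚ-P*P*k+2*m*m m P (n ∸ 2))
    (ℕ→ℚ-mono-≤ (m*n*P≤P*P*[n∸2]+2*m*m n m≤P 4P≤n² (2≤n 1≤P))))))
  where
  1≤P : 1 ℕ.≤ P
  1≤P = ℕ.≤-trans (s≤s z≤n) m≤P

m*S<P*[n∸2] : ∀ {m P S} n → m ℕ.< P → 2 ℕ.* m ℕ.< P ℕ.* (n ∸ 2) → (1 ℕ.≤ P → 2 ℕ.≤ n) →
  S + ℕ→ℚ 2 * inv P * ℕ→ℚ m ≤ ℕ→ℚ n → ℕ→ℚ m * S < ℕ→ℚ (P ℕ.* (n ∸ 2))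
m*S<P*[n∸2] {zero} {P} {S} n _ 0<P[n∸2] _ _ = subst (_< ℕ→ℚ (P ℕ.* (n ∸ 2))) (≡.sym (ℚ.*-zeroˡ S)) (ℕ→ℚ-pos 0<P[n∸2])
m*S<P*[n∸2] {m@(suc _)} {P} {S} n m<P 2m<P[n∸2] 2≤n bound = *-cancelˡ-< (ℕ→ℚ-nonNeg P)
  (+-cancelʳ-< (ℚ.≤-<-trans (P*[m*S]+2*m*m≤m*n*P {m} {P} {S} n 1≤P bound) (subst (ℕ→ℚ (m ℕ.* n ℕ.* P) <_) (ℕ→ℚ-P*P*k+2*m*m m P (n ∸ 2))
    (ℕ→ℚ-mono-< (m*n*P<P*P*[n∸2]+2*m*m n m<P 2m<P[n∸2] (2≤n 1≤P))))))
  where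
  1≤P : 1 ℕ.≤ P
  1≤P = ℕ.≤-trans (s≤s z≤n) m<P

xor-not : ∀ a b → (not a xor not b) ≡ (a xor b)
xor-not a b = trans (≡.sym (not-distribˡ-xor a (not b))) (trans (cong not (≡.sym (not-distribʳ-xor a b))) (not-involutive (a xor b)))

xor≡true⇒≡not : ∀ {a b} → (a xor b) ≡ true → a ≡ not b
xor≡true⇒≡not {true}  {false} _ = refl
xor≡true⇒≡not {false} {true}  _ = refl

-- Bipartite graphs

module Bipartite {n : ℕ} (G : Graph n) (β : Fin n → Bool) (proper : ∀ {u v} → Adj G u v → β u ≡ not (β v)) where

  n₁ n₂ P m : ℕ
  n₁ = count β
  n₂ = count (λ u → not (β u))
  P  = n₁ ℕ.* n₂
  m  = edgeCount G

  private
    d = deg G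

  opposite : Fin n → ℕ
  opposite u = if β u then n₂ else n₁

  n₁+n₂≡n : n₁ ℕ.+ n₂ ≡ n
  n₁+n₂≡n = count-+-count-not β

  4*P≤n*n : 4 ℕ.* P ℕ.≤ n ℕ.* n
  4*P≤n*n = subst (λ z → 4 ℕ.* P ℕ.≤ z ℕ.* z) n₁+n₂≡n (4*ab≤[a+b]² n₁ n₂)

  1≤P⇒2≤n : 1 ℕ.≤ P → 2 ℕ.≤ n
  1≤P⇒2≤n 1≤P = subst (2 ℕ.≤_) n₁+n₂≡n (1≤a*b⇒2≤a+b n₁ n₂ 1≤P)
    where
    1≤a*b⇒2≤a+b : ∀ a b → 1 ℕ.≤ a ℕ.* b → 2 ℕ.≤ a ℕ.+ b
    1≤a*b⇒2≤a+b (suc a) (suc b) _ = s≤s (ℕ.≤-trans (s≤s z≤n) (ℕ.m≤n+m (suc b) a))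
    1≤a*b⇒2≤a+b (suc a) zero 1≤a*0 = ⊥-elim (ℕ.<-irrefl (≡.sym (ℕ.*-zeroʳ (suc a))) 1≤a*0)

  adj≤xor : ∀ u v → 𝟙 (adj G u v) ℕ.≤ 𝟙 (β u xor β v)
  adj≤xor u v with adj G u v in uv
  ... | false = z≤n
  ... | true rewrite proper uv with β v
  ...   | true  = s≤s z≤n
  ...   | false = s≤s z≤n

  count-xor : ∀ u → count (λ v → β u xor β v) ≡ opposite u
  count-xor u with β u
  ... | true  = refl
  ... | false = refl

  deg≤opposite : ∀ u → d u ℕ.≤ opposite u
  deg≤opposite u = subst (d u ℕ.≤_) (count-xor u) (sumℕ-mono-≤ (adj≤xor u))

  opposite*opposite : ∀ {u v} → Adj G u v → opposite u ℕ.* opposite v ≡ P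
  opposite*opposite {u} {v} uv = go (β u) (β v) (proper uv)
    where
    go : ∀ x y → x ≡ not y → (if x then n₂ else n₁) ℕ.* (if y then n₂ else n₁) ≡ P
    go false true  refl = refl
    go true  false refl = ℕ.*-comm n₂ n₁

  opposite+opposite : ∀ {u v} → Adj G u v → opposite u ℕ.+ opposite v ≡ n
  opposite+opposite {u} {v} uv = trans (go (β u) (β v) (proper uv)) n₁+n₂≡n
    where
    go : ∀ x y → x ≡ not y → (if x then n₂ else n₁) ℕ.+ (if y then n₂ else n₁) ≡ n₁ ℕ.+ n₂
    go false true  refl = refl
    go true  false refl = ℕ.+-comm n₂ n₁

  Σopposite≡P+P : sumℕ opposite ≡ P ℕ.+ P
  Σopposite≡P+P = begin
    sumℕ opposite                                                   ≡⟨ sumℕ-cong (λ u → split (β u)) ⟩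
    sumℕ (λ u → 𝟙 (β u) ℕ.* n₂ ℕ.+ 𝟙 (not (β u)) ℕ.* n₁)          ≡⟨ sumℕ-+ (λ u → 𝟙 (β u) ℕ.* n₂) (λ u → 𝟙 (not (β u)) ℕ.* n₁) ⟩
    sumℕ (λ u → 𝟙 (β u) ℕ.* n₂) ℕ.+ sumℕ (λ u → 𝟙 (not (β u)) ℕ.* n₁)
      ≡⟨ cong₂ ℕ._+_ (sumℕ-*ʳ (λ u → 𝟙 (β u)) n₂) (trans (sumℕ-*ʳ (λ u → 𝟙 (not (β u))) n₁) (ℕ.*-comm n₂ n₁)) ⟩
    P ℕ.+ P                                                         ∎
    where
    open ≡-Reasoning
    split : ∀ b → (if b then n₂ else n₁) ≡ 𝟙 b ℕ.* n₂ ℕ.+ 𝟙 (not b) ℕ.* n₁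
    split true  = ≡.sym (trans (ℕ.+-identityʳ (1 ℕ.* n₂)) (ℕ.*-identityˡ n₂))
    split false = ≡.sym (ℕ.*-identityˡ n₁)

  m≤P : m ℕ.≤ P
  m≤P = ℕ.≮⇒≥ (λ P<m → ℕ.<⇒≱ (ℕ.+-mono-< P<m P<m) 2m≤2P)
    where
    2m≤2P : m ℕ.+ m ℕ.≤ P ℕ.+ P
    2m≤2P = subst₂ ℕ._≤_ (handshake G) Σopposite≡P+P (sumℕ-mono-≤ deg≤opposite)

  -- Equality in m ≤ P forces equality in every d(u) ≤ opposite(u), hence in every adjacency.
  m≡P⇒complete : m ≡ P → ∀ u v → adj G u v ≡ (β u xor β v)
  m≡P⇒complete m≡P u v = 𝟙-injective (sumℕ-mono-≤-≡ (adj≤xor u) (trans (deg≡opposite u) (≡.sym (count-xor u))) v)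
    where
    deg≡opposite : ∀ u → d u ≡ opposite u
    deg≡opposite = sumℕ-mono-≤-≡ deg≤opposite (trans (handshake G) (trans (cong₂ ℕ._+_ m≡P m≡P) (≡.sym Σopposite≡P+P)))

  abc²+2/P≤1/d+1/d : ∀ {u v} → Adj G u v → abc² G u v + ℕ→ℚ 2 * inv P ≤ inv (d u) + inv (d v)
  abc²+2/P≤1/d+1/d {u} {v} uv = subst (abc² G u v + ℕ→ℚ 2 * inv P ≤_) (abc²+2/dd≡1/d+1/d G uv)
    (ℚ.+-monoʳ-≤ (abc² G u v) (*-monoˡ-≤ (ℕ→ℚ-nonNeg 2) (inv-antitone (1≤d*d G uv) dd≤P)))
    where
    dd≤P : d u ℕ.* d v ℕ.≤ P
    dd≤P = subst (d u ℕ.* d v ℕ.≤_) (opposite*opposite uv) (ℕ.*-mono-≤ (deg≤opposite u) (deg≤opposite v))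

  Σ1/d≤n : sumOver (adj G) (λ u _ → inv (d u)) ≤ ℕ→ℚ n
  Σ1/d≤n = begin
    sumOver (adj G) (λ u _ → inv (d u))    ≡⟨ sumℚ-cong (λ u → sumℚ-if (adj G u) (inv (d u))) ⟩
    sumℚ (λ u → inv (d u) * ℕ→ℚ (d u))     ≤⟨ sumℚ-mono-≤ (λ u → subst (_≤ 1ℚ) (ℚ.*-comm (ℕ→ℚ (d u)) (inv (d u))) (ℕ→ℚ*inv≤1 (d u))) ⟩
    sumℚ {n} (λ _ → ℕ→ℚ 1)                 ≡⟨ trans (sumℚ-ℕ→ℚ {n} (λ _ → 1)) (cong ℕ→ℚ (trans (sumℕ-const n 1) (ℕ.*-identityʳ n))) ⟩
    ℕ→ℚ n                                  ∎
    where open ℚ.≤-Reasoning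

  Σ1/d′≡Σ1/d : sumOver (adj G) (λ _ v → inv (d v)) ≡ sumOver (adj G) (λ u _ → inv (d u))
  Σ1/d′≡Σ1/d = trans (sumℚ-comm (λ u v → restrict (adj G) (λ _ v → inv (d v)) u v))
    (sumℚ-cong (λ v → sumℚ-cong (λ u → cong (λ b → if b then inv (d v) else 0ℚ) (Graph.sym G u v))))

  Σabc²+2m/P≤n : edgeSum G (abc² G) + ℕ→ℚ 2 * inv P * ℕ→ℚ m ≤ ℕ→ℚ n
  Σabc²+2m/P≤n = x+x≤y+y⇒x≤y (begin
    (S + c * M) + (S + c * M)                          ≡⟨ solve 2 (λ a b → (a :+ b) :+ (a :+ b) := (a :+ a) :+ (b :+ b)) refl S (c * M) ⟩
    (S + S) + (c * M + c * M)                          ≡⟨ cong₂ _+_ (≡.sym (sumOver-adj≡edgeSum+edgeSum G (abc² G) (abc²-sym G)))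
                                                           (≡.sym (trans (sumOver-adj≡edgeSum+edgeSum G (λ _ _ → c) (λ _ _ → refl))
                                                                         (cong (λ z → z + z) (sumOver-const (isEdge G) c)))) ⟩
    sumOver (adj G) (abc² G) + sumOver (adj G) (λ _ _ → c) ≡⟨ sumOver-+ (adj G) (abc² G) (λ _ _ → c) ⟨
    sumOver (adj G) (λ u v → abc² G u v + c)           ≤⟨ sumOver-mono-≤ (adj G) (λ u v uv → abc²+2/P≤1/d+1/d uv) ⟩
    sumOver (adj G) (λ u v → inv (d u) + inv (d v))    ≡⟨ sumOver-+ (adj G) (λ u _ → inv (d u)) (λ _ v → inv (d v)) ⟩
    sumOver (adj G) (λ u _ → inv (d u)) + sumOver (adj G) (λ _ v → inv (d v))
                                                       ≤⟨ ℚ.+-mono-≤ Σ1/d≤n (ℚ.≤-trans (ℚ.≤-reflexive Σ1/d′≡Σ1/d) Σ1/d≤n) ⟩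
    ℕ→ℚ n + ℕ→ℚ n                                      ∎)
    where
    open ℚ.≤-Reasoning
    S = edgeSum G (abc² G)
    c = ℕ→ℚ 2 * inv P
    M = ℕ→ℚ m

  m*Σabc²≤P*[n∸2] : ℕ→ℚ m * edgeSum G (abc² G) ≤ ℕ→ℚ (P ℕ.* (n ∸ 2))
  m*Σabc²≤P*[n∸2] = m*S≤P*[n∸2] n m≤P 4*P≤n*n 1≤P⇒2≤n Σabc²+2m/P≤n

  m*Σabc²<P*[n∸2] : m ℕ.< P → 2 ℕ.* m ℕ.< P ℕ.* (n ∸ 2) → ℕ→ℚ m * edgeSum G (abc² G) < ℕ→ℚ (P ℕ.* (n ∸ 2))
  m*Σabc²<P*[n∸2] m<P 2m<P[n∸2] = m*S<P*[n∸2] n m<P 2m<P[n∸2] 1≤P⇒2≤n Σabc²+2m/P≤n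

  module Complete (complete : ∀ u v → adj G u v ≡ (β u xor β v)) where

    deg≡opposite : ∀ u → d u ≡ opposite u
    deg≡opposite u = trans (sumℕ-cong (λ v → cong 𝟙 (complete u v))) (count-xor u)

    m≡P : m ≡ P
    m≡P = ℕ.≤-antisym m≤P (ℕ.≮⇒≥ (λ m<P → ℕ.<⇒≢ (ℕ.+-mono-< m<P m<P) 2m≡2P))
      where
      2m≡2P : m ℕ.+ m ≡ P ℕ.+ P
      2m≡2P = trans (≡.sym (handshake G)) (trans (sumℕ-cong deg≡opposite) Σopposite≡P+P)

    -- Every edge term is √((n − 2)/P), and there are P edges.
    P*[n∸2]≤edgeSum² : ∀ (p : Fin n → Fin n → ℚ) →
      (∀ u v → Adj G u v → UpperApprox (p u v) (edgeNum G u v) (edgeDen G u v)) →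
      ℕ→ℚ (P ℕ.* (n ∸ 2)) ≤ edgeSum G p * edgeSum G p
    P*[n∸2]≤edgeSum² p upper = cancel-P P (subst (λ z → ℕ→ℚ z * ℕ→ℚ z * ℕ→ℚ (n ∸ 2) ≤ edgeSum G p * edgeSum G p * ℕ→ℚ P) m≡P
      (sumOver-√-scaled (isEdge G) p (ℕ→ℚ-nonNeg (n ∸ 2)) (ℕ→ℚ-nonNeg P) (λ u v e → term (isEdge⇒Adj G e))))
      where
      term : ∀ {u v} → Adj G u v → 0ℚ ≤ p u v × ℕ→ℚ (n ∸ 2) ≤ p u v * p u v * ℕ→ℚ P
      term {u} {v} uv = proj₁ (upper u v uv) , subst₂ (λ x y → ℕ→ℚ (x ∸ 2) ≤ p u v * p u v * ℕ→ℚ y)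
        (trans (cong₂ ℕ._+_ (deg≡opposite u) (deg≡opposite v)) (opposite+opposite uv))
        (trans (cong₂ ℕ._*_ (deg≡opposite u) (deg≡opposite v)) (opposite*opposite uv))
        (proj₂ (upper u v uv))
      cancel-P : ∀ Q → ℕ→ℚ Q * ℕ→ℚ Q * ℕ→ℚ (n ∸ 2) ≤ edgeSum G p * edgeSum G p * ℕ→ℚ Q →
                 ℕ→ℚ (Q ℕ.* (n ∸ 2)) ≤ edgeSum G p * edgeSum G p
      cancel-P zero      _ = square-nonNeg (edgeSum G p)
      cancel-P Q@(suc _) h = *-cancelˡ-≤ (ℕ→ℚ-pos {Q} (s≤s z≤n)) (subst₂ _≤_
        (trans (ℚ.*-assoc (ℕ→ℚ Q) (ℕ→ℚ Q) (ℕ→ℚ (n ∸ 2))) (cong (ℕ→ℚ Q *_) (≡.sym (ℕ→ℚ-* Q (n ∸ 2)))))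
        (ℚ.*-comm (edgeSum G p * edgeSum G p) (ℕ→ℚ Q)) h)

  module _ {N : ℕ} (P[n∸2]≤N/4 : 4 ℕ.* (P ℕ.* (n ∸ 2)) ℕ.≤ N) where

    ABC≤√N/4 : ABC≤√ G (+ N / 4)
    ABC≤√N/4 q lower = ℚ.≤-trans (edgeSum²≤edgeCount*Σabc² G q lower)
      (ℚ.≤-trans m*Σabc²≤P*[n∸2] (ℕ→ℚ≤/4 (P ℕ.* (n ∸ 2)) N P[n∸2]≤N/4))

    ABC≥√N/4⇒N/4≤m*Σabc² : ABC≥√ G (+ N / 4) → + N / 4 ≤ ℕ→ℚ m * edgeSum G (abc² G)
    ABC≥√N/4⇒N/4≤m*Σabc² = ABC≥√⇒≤edgeCount*Σabc² G

    -- A connected G reaching N/4 has 2m < P (n − 2) unless m = P, so the strict bound excludes m < P.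
    connected-ABC≥√N/4⇒m≡P : Connected G → ABC≥√ G (+ N / 4) → m ≡ P
    connected-ABC≥√N/4⇒m≡P connected ABC≥√N/4 = ℕ.≤-antisym m≤P (ℕ.≮⇒≥ (λ m<P → ℚ.<-irrefl refl
      (ℚ.<-≤-trans (m*Σabc²<P*[n∸2] m<P (2*m<P*[n∸2] n m<P 4*P≤n*n
                     (connected⇒n≤2*edgeCount G connected (1≤P⇒2≤n (ℕ.≤-trans (s≤s z≤n) m<P)))))
                   (ℚ.≤-trans (ℕ→ℚ≤/4 (P ℕ.* (n ∸ 2)) N P[n∸2]≤N/4) (ABC≥√N/4⇒N/4≤m*Σabc² ABC≥√N/4)))))

    ABC≥√N/4⇒N≤4*P*[n∸2] : ABC≥√ G (+ N / 4) → N ℕ.≤ 4 ℕ.* (P ℕ.* (n ∸ 2))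
    ABC≥√N/4⇒N≤4*P*[n∸2] ABC≥√N/4 = /4≤ℕ→ℚ⇒ (P ℕ.* (n ∸ 2)) N (ℚ.≤-trans (ABC≥√N/4⇒N/4≤m*Σabc² ABC≥√N/4) m*Σabc²≤P*[n∸2])

2-colouring : ∀ {n} (G : Graph n) → Colorable G 2 → Σ (Fin n → Bool) λ β → ∀ {u v} → Adj G u v → β u ≡ not (β v)
2-colouring G (c , proper) = (λ u → isZero (c u)) , λ uv → ≢⇒≡not (proper _ _ uv)
  where
  isZero : Fin 2 → Bool
  isZero zero    = true
  isZero (suc _) = false
  ≢⇒≡not : ∀ {x y} → ¬ (x ≡ y) → isZero x ≡ not (isZero y)
  ≢⇒≡not {zero}       {zero}       x≢y = ⊥-elim (x≢y refl)
  ≢⇒≡not {zero}       {suc zero}   _   = refl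
  ≢⇒≡not {suc zero}   {zero}       _   = refl
  ≢⇒≡not {suc zero}   {suc zero}   x≢y = ⊥-elim (x≢y refl)

-- (n − 2)(n² − 1) ≤ N ≤ 4 P (n − 2) leaves only the balanced bipartition.
extremal⇒≅T₂ : ∀ {n} (G : Graph n) (β : Fin n → Bool) (proper : ∀ {u v} → Adj G u v → β u ≡ not (β v)) →
  Connected G → ∀ {N} → 4 ℕ.* (Bipartite.P G β proper ℕ.* (n ∸ 2)) ℕ.≤ N → (n ∸ 2) ℕ.* (n ℕ.* n ∸ 1) ℕ.≤ N →
  ABC≥√ G (+ N / 4) → G ≅ T₂ n
extremal⇒≅T₂ {n} G β proper connected {N} P[n∸2]≤N/4 N≥ ABC≥√N/4 =
  from-balance ([a+b]²≤4ab+1⇒balanced n₁ n₂ (subst (λ z → z ℕ.* z ℕ.≤ 4 ℕ.* P ℕ.+ 1) (≡.sym n₁+n₂≡n) n²≤4P+1))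
  where
  open Bipartite G β proper
  m≡P : m ≡ P
  m≡P = connected-ABC≥√N/4⇒m≡P P[n∸2]≤N/4 connected ABC≥√N/4
  2≤k+k⇒1≤k : ∀ {k} → 2 ℕ.≤ k ℕ.+ k → 1 ℕ.≤ k
  2≤k+k⇒1≤k {suc _} _ = s≤s z≤n
  n²≤4P+1 : n ℕ.* n ℕ.≤ 4 ℕ.* P ℕ.+ 1
  n²≤4P+1 = n*n≤4*P+1 n (λ 2≤n → subst (1 ℕ.≤_) m≡P (2≤k+k⇒1≤k (ℕ.≤-trans 2≤n (connected⇒n≤2*edgeCount G connected 2≤n))))
    N≥ (ABC≥√N/4⇒N≤4*P*[n∸2] P[n∸2]≤N/4 ABC≥√N/4)
  complete : ∀ u v → adj G u v ≡ (β u xor β v)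
  complete = m≡P⇒complete m≡P
  from-balance : n₁ ≡ (n₁ ℕ.+ n₂) ℕ./ 2 ⊎ n₂ ≡ (n₁ ℕ.+ n₂) ℕ./ 2 → G ≅ T₂ n
  from-balance (inj₁ n₁≡) = ≅T₂ G β complete (trans n₁≡ (cong (ℕ._/ 2) n₁+n₂≡n))
  from-balance (inj₂ n₂≡) = ≅T₂ G (λ u → not (β u)) (λ u v → trans (complete u v) (≡.sym (xor-not (β u) (β v))))
                                 (trans n₂≡ (cong (ℕ._/ 2) n₁+n₂≡n))

-- An isomorphism with T_{n,2} pulls back its bipartition to a complete one with parts ⌊n/2⌋ and ⌈n/2⌉.
≅T₂⇒ABC≥√N/4 : ∀ {n} (G : Graph n) → G ≅ T₂ n → ∀ {N} → N ℕ.≤ 4 ℕ.* (n ℕ./ 2 ℕ.* (n ∸ n ℕ./ 2) ℕ.* (n ∸ 2)) →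
  ABC≥√ G (+ N / 4)
≅T₂⇒ABC≥√N/4 {n} G (π , adj≡) {N} N≤ p upper = ℚ.≤-trans N/4≤P[n∸2] (Complete.P*[n∸2]≤edgeSum² adj≡ p upper)
  where
  half : Fin n → Bool
  half i = toℕ i <ᵇ n ℕ./ 2
  β : Fin n → Bool
  β u = half (Bijection.to π u)
  open Bipartite G β (λ {u} {v} uv → xor≡true⇒≡not (trans (≡.sym (adj≡ u v)) uv))
  n₁≡ : n₁ ≡ n ℕ./ 2
  n₁≡ = trans (sumℕ-bijection π (λ i → 𝟙 (half i))) (count-<ᵇ n (n ℕ./ 2) (ℕ.m/n≤m n 2))
  n₂≡ : n₂ ≡ n ∸ n ℕ./ 2
  n₂≡ = trans (≡.sym (ℕ.m+n∸m≡n n₁ n₂)) (≡.cong₂ _∸_ n₁+n₂≡n n₁≡)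
  N/4≤P[n∸2] : + N / 4 ≤ ℕ→ℚ (P ℕ.* (n ∸ 2))
  N/4≤P[n∸2] = /4≤ℕ→ℚ (P ℕ.* (n ∸ 2)) N (subst (λ z → N ℕ.≤ 4 ℕ.* (z ℕ.* (n ∸ 2))) (≡.sym (≡.cong₂ ℕ._*_ n₁≡ n₂≡)) N≤)

-- N bounds 4 a b (n − 2) over all splits a + b = n, is attained by the balanced split, and is at
-- least (n − 2)(n² − 1), which exceeds 4 a b (n − 2) whenever |a − b| ≥ 2 and n > 2.
bipartite-ABC-bound : ∀ {n} (G : Graph n) → Connected G → ChromaticNumberIs G 2 → ∀ N →
  (∀ a b → a ℕ.+ b ≡ n → 4 ℕ.* (a ℕ.* b ℕ.* (n ∸ 2)) ℕ.≤ N) →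
  (n ∸ 2) ℕ.* (n ℕ.* n ∸ 1) ℕ.≤ N →
  N ℕ.≤ 4 ℕ.* (n ℕ./ 2 ℕ.* (n ∸ n ℕ./ 2) ℕ.* (n ∸ 2)) →
  ABC≤√ G (+ N / 4) × (ABC≡√ G (+ N / 4) ⇔ G ≅ T₂ n)
bipartite-ABC-bound {n} G connected (colourable , _) N maximal N≥ attained =
  ABC≤√N/4 bound ,
  mk⇔ (λ ABC≡√N/4 → extremal⇒≅T₂ G β proper connected bound N≥ (proj₂ ABC≡√N/4))
      (λ G≅T₂ → ABC≤√N/4 bound , ≅T₂⇒ABC≥√N/4 G G≅T₂ attained)
  where
  colouring : Σ (Fin n → Bool) λ β → ∀ {u v} → Adj G u v → β u ≡ not (β v)
  colouring = 2-colouring G colourable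
  β = proj₁ colouring
  proper = proj₂ colouring
  open Bipartite G β proper
  bound : 4 ℕ.* (P ℕ.* (n ∸ 2)) ℕ.≤ N
  bound = maximal n₁ n₂ n₁+n₂≡n

proposition5p2 : ∀ (n : ℕ) (G : Graph n) → Connected G → ChromaticNumberIs G 2 →
    ((2 ∣ n) → ABC≤√ G (boundEven² n) × (ABC≡√ G (boundEven² n) ⇔ G ≅ T₂ n))
    × (¬ (2 ∣ n) → ABC≤√ G (boundOdd² n) × (ABC≡√ G (boundOdd² n) ⇔ G ≅ T₂ n))
proposition5p2 n G connected χ≡2 =
  (λ even → bipartite-ABC-bound G connected χ≡2 (n ℕ.* n ℕ.* (n ∸ 2))
              (λ a b → 4*a*b*[n∸2]≤n*n*[n∸2] {a} {b} n) ([n∸2]*[n*n∸1]≤n*n*[n∸2] n)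
              (ℕ.≤-reflexive (n*n*[n∸2]≡4*⌊n/2⌋*⌈n/2⌉*[n∸2] n even))) ,
  (λ odd → bipartite-ABC-bound G connected χ≡2 ((n ∸ 2) ℕ.* (n ℕ.* n ∸ 1))
              (λ a b → 4*a*b*[n∸2]≤[n∸2]*[n*n∸1] {a} {b} n odd) ℕ.≤-refl
              (ℕ.≤-reflexive ([n∸2]*[n*n∸1]≡4*⌊n/2⌋*⌈n/2⌉*[n∸2] n odd)))
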